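{- Let $A\in\mathbb{F}_2[x]$ be special and perfect. Then $$A=\mathrm{rad}(A)+\sum_{\substack{D\mid A,\ D\neq A,\ D\neq 1\\ D\text{ square-free}}}\sigma^{*\mathrm{inv}}(D)\cdot\sigma\!\left(\frac{A}{D}\right).$$
   Context: $\sigma(A)$ is the sum of all divisors of $A$ in $\mathbb{F}_2[x]$; $A$ is perfect if $\sigma(A)=A$. $A$ is special if $A=S^2$ for some square-free $S\in\mathbb{F}_2[x]$ (a notion used for odd perfect polynomials, i.e. perfect polynomials with no irreducible factor of degree $1$). $\mathrm{rad}(A)$ is the product of the distinct irreducible factors of $A$. A divisor $D$ of $A$ is unitary if $\gcd(D,A/D)=1$, and $\sigma^*(A)$ is the sum of all unitary divisors of $A$. A function $f:\mathbb{F}_2[x]\setminus\{0\}\to\mathbb{F}_2[x]$ is multiplicative if $f(AB)=f(A)f(B)$ whenever $\gcd(A,B)=1$; the Dirichlet convolution is $(f*g)(A)=\sum_{D\mid A}f(D)g(A/D)$; $\delta(1)=1$, $\delta(A)=0$ for $A\ne1$; $\sigma^{*\mathrm{inv}}$ is the unique multiplicative function with $\sigma^**\sigma^{*\mathrm{inv}}=\delta$. Sums over $D\mid A$ run over all divisors of $A$ in $\mathbb{F}_2[x]$. -}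

module Defs where

open import Data.Bool using (Bool; true; false; _xor_; _∧_; not; if_then_else_)
open import Data.Nat using (ℕ; zero; suc)
open import Data.List using (List; []; _∷_; _++_; map; reverse; length; concatMap; upTo; foldr; filter; cartesianProduct)
open import Data.Bool.ListAction using (all; any)
import Data.List.Properties as LP
import Data.Bool.Properties as BP
open import Data.Product using (Σ; _×_; _,_; proj₁; proj₂)
open import Data.Sum using (_⊎_)
open import Relation.Binary.PropositionalEquality using (_≡_; _≢_; refl; cong)
open import Relation.Nullary using (Dec; yes; no; ¬_)
open import Relation.Nullary.Decidable using (⌊_⌋)

-- Polynomials over F₂, in canonical form.
--   0p       is the zero polynomial
--   lead cs  is x^n + c_{n-1} x^{n-1} + … + c_0 where cs = c_{n-1} ∷ … ∷ c_0
--            (coefficients listed from high to low degree, n = length cs).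
-- Every polynomial has exactly one representation, so _≡_ is equality in F₂[x].

data Poly : Set where
  0p   : Poly
  lead : List Bool → Poly

1p : Poly
1p = lead []

-- degree (deg 0 := 0 by convention; only used as an enumeration bound)
deg : Poly → ℕ
deg 0p        = 0
deg (lead cs) = length cs

-- coefficient list, lowest degree first, no trailing zeros
coeffs : Poly → List Bool
coeffs 0p        = []
coeffs (lead cs) = reverse (true ∷ cs)

-- from an arbitrary low-first coefficient list (trailing zeros allowed)
private
  dropFalse : List Bool → Poly
  dropFalse []           = 0p
  dropFalse (false ∷ bs) = dropFalse bs
  dropFalse (true ∷ bs)  = lead bs

fromCoeffs : List Bool → Poly
fromCoeffs bs = dropFalse (reverse bs)

addL : List Bool → List Bool → List Bool
addL []       qs       = qs
addL (p ∷ ps) []       = p ∷ ps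
addL (p ∷ ps) (q ∷ qs) = (p xor q) ∷ addL ps qs

mulL : List Bool → List Bool → List Bool
mulL []       qs = []
mulL (p ∷ ps) qs = addL (if p then qs else []) (false ∷ mulL ps qs)

infixl 6 _+_
infixl 7 _*_

_+_ : Poly → Poly → Poly
p + q = fromCoeffs (addL (coeffs p) (coeffs q))

_*_ : Poly → Poly → Poly
p * q = fromCoeffs (mulL (coeffs p) (coeffs q))

infix 4 _≟_ _==_
_≟_ : (p q : Poly) → Dec (p ≡ q)
0p ≟ 0p = yes refl
0p ≟ lead _ = no (λ ())
lead _ ≟ 0p = no (λ ())
lead cs ≟ lead ds with LP.≡-dec BP._≟_ cs ds
... | yes refl = yes refl
... | no ne = no (λ { refl → ne refl })

_==_ : Poly → Poly → Bool
p == q = ⌊ p ≟ q ⌋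

sumP : List Poly → Poly
sumP = foldr _+_ 0p

prodP : List Poly → Poly
prodP = foldr _*_ 1p

infix 4 _∣_
_∣_ : Poly → Poly → Set
D ∣ A = Σ Poly (λ C → D * C ≡ A)

-- the only unit of F₂[x] is 1
Irreducible : Poly → Set
Irreducible P = P ≢ 0p × P ≢ 1p × (∀ D → D ∣ P → D ≡ 1p ⊎ D ≡ P)

SquareFree : Poly → Set
SquareFree S = S ≢ 0p × (∀ P → Irreducible P → ¬ (P * P ∣ S))

Special : Poly → Set
Special A = Σ Poly (λ S → SquareFree S × A ≡ S * S)

allLists : ℕ → List (List Bool)
allLists zero    = [] ∷ []
allLists (suc k) = map (false ∷_) (allLists k) ++ map (true ∷_) (allLists k)

polysUpTo : ℕ → List Poly
polysUpTo n = 0p ∷ concatMap (λ k → map lead (allLists k)) (upTo (suc n))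

-- for A ≠ 0: the list of pairs (D , A/D) with D ranging over the divisors
-- of A, each divisor exactly once (a cofactor of a divisor has degree ≤ deg A)
divisorPairs : Poly → List (Poly × Poly)
divisorPairs A =
  filter (λ dc → proj₁ dc * proj₂ dc ≟ A)
         (cartesianProduct (polysUpTo (deg A)) (polysUpTo (deg A)))

divisors : Poly → List Poly
divisors A = map proj₁ (divisorPairs A)

irreducibleᵇ : Poly → Bool
irreducibleᵇ P = not (P == 0p) ∧ not (P == 1p)
                 ∧ all (λ D → (D == 1p) Data.Bool.∨ (D == P)) (divisors P)

squareFreeᵇ : Poly → Bool
squareFreeᵇ S = not (S == 0p)
                ∧ not (any (λ P → irreducibleᵇ P ∧ any (λ Q → Q == (P * P)) (divisors S))
                           (divisors S))

coprimeᵇ : Poly → Poly → Bool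
coprimeᵇ D C = all (λ E → not (any (λ F → F == E) (divisors C)) Data.Bool.∨ (E == 1p))
                   (divisors D)

σ : Poly → Poly
σ A = sumP (divisors A)

σ* : Poly → Poly
σ* A = sumP (map proj₁ (filter (λ dc → coprimeᵇ (proj₁ dc) (proj₂ dc) Data.Bool.≟ true)
                               (divisorPairs A)))

rad : Poly → Poly
rad A = prodP (filter (λ D → irreducibleᵇ D Data.Bool.≟ true) (divisors A))

Perfect : Poly → Set
Perfect A = σ A ≡ A

_⊛_ : (Poly → Poly) → (Poly → Poly) → Poly → Poly
(f ⊛ g) A = sumP (map (λ dc → f (proj₁ dc) * g (proj₂ dc)) (divisorPairs A))

δ : Poly → Poly
δ A = if A == 1p then 1p else 0p

Coprime : Poly → Poly → Set
Coprime A B = ∀ E → E ∣ A → E ∣ B → E ≡ 1p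

Multiplicative : (Poly → Poly) → Set
Multiplicative f = ∀ A B → A ≢ 0p → B ≢ 0p → Coprime A B → f (A * B) ≡ f A * f B

-- f is σ^{*inv}: the (unique) multiplicative function with σ* ⊛ f = δ
-- (on the domain F₂[x] ∖ {0})
IsσStarInv : (Poly → Poly) → Set
IsσStarInv f = Multiplicative f × (∀ A → A ≢ 0p → (σ* ⊛ f) A ≡ δ A)

corSum : (Poly → Poly) → Poly → Poly
corSum f A =
  sumP (map (λ dc → f (proj₁ dc) * σ (proj₂ dc))
            (filter (λ dc → not (proj₁ dc == A) ∧ not (proj₁ dc == 1p)
                            ∧ squareFreeᵇ (proj₁ dc) Data.Bool.≟ true)
                    (divisorPairs A)))

module Submission where

-- Put g(A) = Σ_{D ∣ A, D square-free} σ*⁻¹(D) σ(A/D).  Square-freeness, σ and σ*⁻¹ are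
-- multiplicative, hence so is g.  For irreducible P, σ*⁻¹(P) = 1 + P, so over F₂
-- g(P²) = σ(P²) + (1 + P) σ(P) = (1 + P + P²) + (1 + P²) = P; thus g(S²) = S = rad(S²)
-- for every square-free S.  For A = S² perfect with S ≠ 1, the term D = 1 of g(A) is
-- σ(A) = A and the term D = A vanishes, so rad A = g(A) = A + (the sum in the statement).

open import Defs
open import Algebra.Bundles using (CommutativeSemiring; CommutativeRing)
open import Algebra.Structures using (IsCommutativeSemiring)
import Algebra.Properties.CommutativeSemigroup as CommutativeSemigroupProperties
open import Data.Bool using (Bool; true; false; _xor_; _∧_; _∨_; not; if_then_else_)
import Data.Bool as Bool
open import Data.Bool.ListAction using (all; any)
open import Data.Bool.Properties
  using (xor-comm; xor-assoc; xor-same; xor-identityʳ; ∧-comm; ∧-distribʳ-xor; ∨-zeroʳ; xor-∧-commutativeRing; T-≡; ⇔→≡)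
open import Data.Empty using (⊥; ⊥-elim)
open import Data.List
  using (List; []; _∷_; _++_; _∷ʳ_; reverse; length; replicate; map; concatMap; filter; upTo; cartesianProduct)
open import Data.List.Properties
  using (reverse-++; reverse-involutive; unfold-reverse; length-reverse; length-++; length-replicate;
         ++-assoc; ++-identityʳ; ∷-injectiveʳ; map-∘)
open import Data.List.Reverse using (Reverse; reverseView; _∶_∶ʳ_) renaming ([] to []ʳ)
open import Data.List.Membership.Propositional using (_∈_; _∉_; find; lose)
open import Data.List.Membership.Propositional.Properties
  using (∈-map⁺; ∈-map⁻; ∈-concatMap⁺; ∈-concatMap⁻; ∈-++⁺ˡ; ∈-++⁺ʳ; ∈-++⁻; ∈-∃++; ∈-upTo⁺;
         ∈-filter⁺; ∈-filter⁻; ∈-cartesianProduct⁺; ∈-cartesianProduct⁻)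
open import Data.List.Relation.Unary.Any using (Any; here; there)
import Data.List.Relation.Unary.Any as Any
open import Data.List.Relation.Unary.Any.Properties using (any⁺; any⁻)
open import Data.List.Relation.Unary.All as All using (All; []; _∷_)
open import Data.List.Relation.Unary.AllPairs using ([]; _∷_)
open import Data.List.Relation.Unary.Unique.Propositional using (Unique)
import Data.List.Relation.Unary.Unique.Propositional.Properties as Unique
open import Data.List.Relation.Binary.Permutation.Propositional using (_↭_; prep; ↭-refl; ↭-sym; ↭-trans; ↭⇒↭ₛ)
import Data.List.Relation.Binary.Permutation.Propositional.Properties as ↭
open import Data.Maybe using (nothing)
open import Data.Nat using (ℕ; zero; suc; _≤_; _<_; z≤n; s≤s; _∸_) renaming (_+_ to _+ℕ_)
import Data.Nat.Properties as ℕ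
open import Data.Product using (∃; ∃₂; _×_; _,_; proj₁; proj₂)
open import Data.Sum using (_⊎_; inj₁; inj₂)
open import Function using (Equivalence; mk⇔)
open import Relation.Binary.Bundles using (Setoid)
open import Relation.Binary.PropositionalEquality
  using (_≡_; _≢_; refl; sym; trans; cong; cong₂; subst; setoid; isEquivalence; module ≡-Reasoning)
import Relation.Binary.Reasoning.Setoid as SetoidReasoning
open import Relation.Nullary using (¬_; Dec; yes; no; does)
open import Relation.Unary using (Pred; Decidable)
open import Tactic.RingSolver using (solve-∀)
open import Tactic.RingSolver.Core.AlmostCommutativeRing using (AlmostCommutativeRing; fromCommutativeSemiring)
open import Data.List.Relation.Binary.Permutation.Setoid.Properties (setoid Poly) using (foldr-commMonoid)

private
  module Xor = CommutativeSemigroupProperties (CommutativeRing.+-commutativeSemigroup xor-∧-commutativeRing)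

-- The ring F₂[x]

coeff : List Bool → ℕ → Bool
coeff []       _       = false
coeff (b ∷ bs) zero    = b
coeff (b ∷ bs) (suc n) = coeff bs n

infix 4 _≈_
record _≈_ (as bs : List Bool) : Set where
  constructor coeffwise
  field coeff-≡ : ∀ n → coeff as n ≡ coeff bs n
open _≈_

≈-refl : ∀ {as} → as ≈ as
≈-refl = coeffwise λ _ → refl

≈-reflexive : ∀ {as bs} → as ≡ bs → as ≈ bs
≈-reflexive refl = ≈-refl

≈-sym : ∀ {as bs} → as ≈ bs → bs ≈ as
≈-sym p = coeffwise λ n → sym (coeff-≡ p n)

≈-trans : ∀ {as bs cs} → as ≈ bs → bs ≈ cs → as ≈ cs
≈-trans p q = coeffwise λ n → trans (coeff-≡ p n) (coeff-≡ q n)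

≈-setoid : Setoid _ _
≈-setoid = record
  { Carrier = List Bool
  ; _≈_ = _≈_
  ; isEquivalence = record { refl = ≈-refl ; sym = ≈-sym ; trans = ≈-trans } }

∷-cong : ∀ {b c bs cs} → b ≡ c → bs ≈ cs → b ∷ bs ≈ c ∷ cs
∷-cong {bs = bs} {cs} refl p = coeffwise λ { zero → refl ; (suc n) → coeff-≡ p n }

∷-injective : ∀ {b c bs cs} → b ∷ bs ≈ c ∷ cs → b ≡ c × bs ≈ cs
∷-injective p = coeff-≡ p zero , coeffwise λ n → coeff-≡ p (suc n)

false∷[]≈[] : false ∷ [] ≈ []
false∷[]≈[] = coeffwise λ { zero → refl ; (suc n) → refl }

coeff-addL : ∀ as bs n → coeff (addL as bs) n ≡ coeff as n xor coeff bs n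
coeff-addL []       bs       n       = refl
coeff-addL (a ∷ as) []       n       = sym (xor-identityʳ _)
coeff-addL (a ∷ as) (b ∷ bs) zero    = refl
coeff-addL (a ∷ as) (b ∷ bs) (suc n) = coeff-addL as bs n

addL-coeffwise : ∀ as bs cs ds →
  (∀ n → coeff as n xor coeff bs n ≡ coeff cs n xor coeff ds n) → addL as bs ≈ addL cs ds
addL-coeffwise as bs cs ds eq = coeffwise λ n →
  trans (coeff-addL as bs n) (trans (eq n) (sym (coeff-addL cs ds n)))

addL-cong : ∀ {as as′ bs bs′} → as ≈ as′ → bs ≈ bs′ → addL as bs ≈ addL as′ bs′
addL-cong {as} {as′} {bs} {bs′} p q = addL-coeffwise as bs as′ bs′ λ n → cong₂ _xor_ (coeff-≡ p n) (coeff-≡ q n)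

addL-comm : ∀ as bs → addL as bs ≈ addL bs as
addL-comm as bs = addL-coeffwise as bs bs as λ n → xor-comm (coeff as n) (coeff bs n)

addL-assoc : ∀ as bs cs → addL (addL as bs) cs ≈ addL as (addL bs cs)
addL-assoc as bs cs = coeffwise λ n → begin
  coeff (addL (addL as bs) cs) n                 ≡⟨ coeff-addL (addL as bs) cs n ⟩
  coeff (addL as bs) n xor coeff cs n            ≡⟨ cong (_xor coeff cs n) (coeff-addL as bs n) ⟩
  (coeff as n xor coeff bs n) xor coeff cs n     ≡⟨ xor-assoc (coeff as n) (coeff bs n) (coeff cs n) ⟩
  coeff as n xor (coeff bs n xor coeff cs n)     ≡⟨ cong (coeff as n xor_) (coeff-addL bs cs n) ⟨
  coeff as n xor coeff (addL bs cs) n            ≡⟨ coeff-addL as (addL bs cs) n ⟨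
  coeff (addL as (addL bs cs)) n                 ∎
  where open ≡-Reasoning

addL-identityʳ : ∀ as → addL as [] ≡ as
addL-identityʳ []       = refl
addL-identityʳ (a ∷ as) = refl

addL-self : ∀ as → addL as as ≈ []
addL-self as = coeffwise λ n → trans (coeff-addL as as n) (xor-same (coeff as n))

addL-interchange : ∀ as bs cs ds → addL (addL as bs) (addL cs ds) ≈ addL (addL as cs) (addL bs ds)
addL-interchange as bs cs ds = coeffwise λ n → begin
  coeff (addL (addL as bs) (addL cs ds)) n
    ≡⟨ coeff-addL (addL as bs) (addL cs ds) n ⟩
  coeff (addL as bs) n xor coeff (addL cs ds) n
    ≡⟨ cong₂ _xor_ (coeff-addL as bs n) (coeff-addL cs ds n) ⟩
  (coeff as n xor coeff bs n) xor (coeff cs n xor coeff ds n)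
    ≡⟨ Xor.interchange (coeff as n) (coeff bs n) (coeff cs n) (coeff ds n) ⟩
  (coeff as n xor coeff cs n) xor (coeff bs n xor coeff ds n)
    ≡⟨ cong₂ _xor_ (coeff-addL as cs n) (coeff-addL bs ds n) ⟨
  coeff (addL as cs) n xor coeff (addL bs ds) n
    ≡⟨ coeff-addL (addL as cs) (addL bs ds) n ⟨
  coeff (addL (addL as cs) (addL bs ds)) n ∎
  where open ≡-Reasoning

addL-leftComm : ∀ as bs cs → addL as (addL bs cs) ≈ addL bs (addL as cs)
addL-leftComm as bs cs = coeffwise λ n → begin
  coeff (addL as (addL bs cs)) n               ≡⟨ coeff-addL as (addL bs cs) n ⟩
  coeff as n xor coeff (addL bs cs) n          ≡⟨ cong (coeff as n xor_) (coeff-addL bs cs n) ⟩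
  coeff as n xor (coeff bs n xor coeff cs n)   ≡⟨ Xor.x∙yz≈y∙xz (coeff as n) (coeff bs n) (coeff cs n) ⟩
  coeff bs n xor (coeff as n xor coeff cs n)   ≡⟨ cong (coeff bs n xor_) (coeff-addL as cs n) ⟨
  coeff bs n xor coeff (addL as cs) n          ≡⟨ coeff-addL bs (addL as cs) n ⟨
  coeff (addL bs (addL as cs)) n               ∎
  where open ≡-Reasoning

scale : Bool → List Bool → List Bool
scale b bs = if b then bs else []

coeff-scale : ∀ b bs n → coeff (scale b bs) n ≡ b ∧ coeff bs n
coeff-scale true  bs n = refl
coeff-scale false bs n = refl

scale-cong : ∀ b {bs cs} → bs ≈ cs → scale b bs ≈ scale b cs
scale-cong true  p = p
scale-cong false p = ≈-refl

scale-[] : ∀ b → scale b [] ≡ []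
scale-[] true  = refl
scale-[] false = refl

scale-∷ : ∀ b c cs → scale b (c ∷ cs) ≈ (b ∧ c) ∷ scale b cs
scale-∷ true  c cs = ≈-refl
scale-∷ false c cs = ≈-sym false∷[]≈[]

scale-distribʳ-xor : ∀ b c cs → scale (b xor c) cs ≈ addL (scale b cs) (scale c cs)
scale-distribʳ-xor b c cs = coeffwise λ n → begin
  coeff (scale (b xor c) cs) n                              ≡⟨ coeff-scale (b xor c) cs n ⟩
  (b xor c) ∧ coeff cs n                                    ≡⟨ ∧-distribʳ-xor (coeff cs n) b c ⟩
  (b ∧ coeff cs n) xor (c ∧ coeff cs n)                     ≡⟨ cong₂ _xor_ (coeff-scale b cs n) (coeff-scale c cs n) ⟨
  coeff (scale b cs) n xor coeff (scale c cs) n             ≡⟨ coeff-addL (scale b cs) (scale c cs) n ⟨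
  coeff (addL (scale b cs) (scale c cs)) n                  ∎
  where open ≡-Reasoning

mulL-scaleˡ : ∀ b bs cs → mulL (scale b bs) cs ≡ scale b (mulL bs cs)
mulL-scaleˡ true  bs cs = refl
mulL-scaleˡ false bs cs = refl

mulL-zeroʳ : ∀ as → mulL as [] ≈ []
mulL-zeroʳ []       = ≈-refl
mulL-zeroʳ (a ∷ as) rewrite scale-[] a = ≈-trans (∷-cong refl (mulL-zeroʳ as)) false∷[]≈[]

mulL-congʳ : ∀ as {bs cs} → bs ≈ cs → mulL as bs ≈ mulL as cs
mulL-congʳ []       p = ≈-refl
mulL-congʳ (a ∷ as) p = addL-cong (scale-cong a p) (∷-cong refl (mulL-congʳ as p))

mulL-distribʳ : ∀ as bs cs → mulL (addL as bs) cs ≈ addL (mulL as cs) (mulL bs cs)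
mulL-distribʳ []       bs       cs = ≈-refl
mulL-distribʳ (a ∷ as) []       cs = ≈-reflexive (sym (addL-identityʳ (mulL (a ∷ as) cs)))
mulL-distribʳ (a ∷ as) (b ∷ bs) cs = begin
  addL (scale (a xor b) cs) (false ∷ mulL (addL as bs) cs)
    ≈⟨ addL-cong (scale-distribʳ-xor a b cs) (∷-cong refl (mulL-distribʳ as bs cs)) ⟩
  addL (addL (scale a cs) (scale b cs)) (addL (false ∷ mulL as cs) (false ∷ mulL bs cs))
    ≈⟨ addL-interchange (scale a cs) (scale b cs) (false ∷ mulL as cs) (false ∷ mulL bs cs) ⟩
  addL (mulL (a ∷ as) cs) (mulL (b ∷ bs) cs) ∎
  where open SetoidReasoning ≈-setoid

mulL-∷ʳ : ∀ as b bs → mulL as (b ∷ bs) ≈ addL (scale b as) (false ∷ mulL as bs)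
mulL-∷ʳ []       b bs rewrite scale-[] b = ≈-sym false∷[]≈[]
mulL-∷ʳ (a ∷ as) b bs = begin
  addL (scale a (b ∷ bs)) (false ∷ mulL as (b ∷ bs))
    ≈⟨ addL-cong (scale-∷ a b bs) (∷-cong refl (mulL-∷ʳ as b bs)) ⟩
  ((a ∧ b) xor false) ∷ addL (scale a bs) (addL (scale b as) (false ∷ mulL as bs))
    ≈⟨ ∷-cong (cong (_xor false) (∧-comm a b)) (addL-leftComm (scale a bs) (scale b as) _) ⟩
  ((b ∧ a) xor false) ∷ addL (scale b as) (addL (scale a bs) (false ∷ mulL as bs))
    ≈⟨ addL-cong (scale-∷ b a as) ≈-refl ⟨
  addL (scale b (a ∷ as)) (false ∷ mulL (a ∷ as) bs) ∎
  where open SetoidReasoning ≈-setoid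

mulL-comm : ∀ as bs → mulL as bs ≈ mulL bs as
mulL-comm []       bs = ≈-sym (mulL-zeroʳ bs)
mulL-comm (a ∷ as) bs =
  ≈-trans (addL-cong ≈-refl (∷-cong refl (mulL-comm as bs))) (≈-sym (mulL-∷ʳ bs a as))

mulL-congˡ : ∀ {as bs} cs → as ≈ bs → mulL as cs ≈ mulL bs cs
mulL-congˡ {as} {bs} cs p =
  ≈-trans (mulL-comm as cs) (≈-trans (mulL-congʳ cs p) (mulL-comm cs bs))

mulL-assoc : ∀ as bs cs → mulL (mulL as bs) cs ≈ mulL as (mulL bs cs)
mulL-assoc []       bs cs = ≈-refl
mulL-assoc (a ∷ as) bs cs =
  ≈-trans (mulL-distribʳ (scale a bs) (false ∷ mulL as bs) cs)
          (addL-cong (≈-reflexive (mulL-scaleˡ a bs cs)) (∷-cong refl (mulL-assoc as bs cs)))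

mulL-identityˡ : ∀ bs → mulL (true ∷ []) bs ≈ bs
mulL-identityˡ bs =
  ≈-trans (addL-cong ≈-refl false∷[]≈[]) (≈-reflexive (addL-identityʳ bs))

-- consP b p = b + x p
consP : Bool → Poly → Poly
consP b 0p        = if b then 1p else 0p
consP b (lead cs) = lead (cs ++ b ∷ [])

fromCoeffs-∷ʳ-true : ∀ bs → fromCoeffs (bs ∷ʳ true) ≡ lead (reverse bs)
fromCoeffs-∷ʳ-true bs rewrite reverse-++ bs (true ∷ []) = refl

fromCoeffs-∷ʳ-false : ∀ bs → fromCoeffs (bs ∷ʳ false) ≡ fromCoeffs bs
fromCoeffs-∷ʳ-false bs rewrite reverse-++ bs (false ∷ []) = refl

fromCoeffs-∷ : ∀ b bs → fromCoeffs (b ∷ bs) ≡ consP b (fromCoeffs bs)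
fromCoeffs-∷ b bs = go bs (reverseView bs)
  where
  go : ∀ bs → Reverse bs → fromCoeffs (b ∷ bs) ≡ consP b (fromCoeffs bs)
  go _ []ʳ = consP-0p b
    where
    consP-0p : ∀ b → fromCoeffs (b ∷ []) ≡ consP b 0p
    consP-0p true  = refl
    consP-0p false = refl
  go _ (cs ∶ r ∶ʳ true) = begin
    fromCoeffs ((b ∷ cs) ∷ʳ true)      ≡⟨ fromCoeffs-∷ʳ-true (b ∷ cs) ⟩
    lead (reverse (b ∷ cs))            ≡⟨ cong lead (unfold-reverse b cs) ⟩
    consP b (lead (reverse cs))        ≡⟨ cong (consP b) (fromCoeffs-∷ʳ-true cs) ⟨
    consP b (fromCoeffs (cs ∷ʳ true))  ∎
    where open ≡-Reasoning
  go _ (cs ∶ r ∶ʳ false) = begin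
    fromCoeffs ((b ∷ cs) ∷ʳ false)     ≡⟨ fromCoeffs-∷ʳ-false (b ∷ cs) ⟩
    fromCoeffs (b ∷ cs)                ≡⟨ go cs r ⟩
    consP b (fromCoeffs cs)            ≡⟨ cong (consP b) (fromCoeffs-∷ʳ-false cs) ⟨
    consP b (fromCoeffs (cs ∷ʳ false)) ∎
    where open ≡-Reasoning

fromCoeffs-≈[] : ∀ bs → bs ≈ [] → fromCoeffs bs ≡ 0p
fromCoeffs-≈[] []       p = refl
fromCoeffs-≈[] (b ∷ bs) p with ∷-injective {bs = bs} {cs = []} (≈-trans p (≈-sym false∷[]≈[]))
... | refl , q = trans (fromCoeffs-∷ false bs) (cong (consP false) (fromCoeffs-≈[] bs q))

fromCoeffs-cong : ∀ {bs cs} → bs ≈ cs → fromCoeffs bs ≡ fromCoeffs cs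
fromCoeffs-cong {[]}     {cs}     p = sym (fromCoeffs-≈[] cs (≈-sym p))
fromCoeffs-cong {b ∷ bs} {[]}     p = fromCoeffs-≈[] (b ∷ bs) p
fromCoeffs-cong {b ∷ bs} {c ∷ cs} p with ∷-injective p
... | refl , q = trans (fromCoeffs-∷ b bs)
                   (trans (cong (consP b) (fromCoeffs-cong q)) (sym (fromCoeffs-∷ b cs)))

coeffs-consP : ∀ b p → coeffs (consP b p) ≈ b ∷ coeffs p
coeffs-consP true  0p        = ≈-refl
coeffs-consP false 0p        = ≈-sym false∷[]≈[]
coeffs-consP b     (lead cs) = ≈-reflexive (reverse-++ (true ∷ cs) (b ∷ []))

coeffs-fromCoeffs : ∀ bs → coeffs (fromCoeffs bs) ≈ bs
coeffs-fromCoeffs []       = ≈-refl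
coeffs-fromCoeffs (b ∷ bs) rewrite fromCoeffs-∷ b bs =
  ≈-trans (coeffs-consP b (fromCoeffs bs)) (∷-cong refl (coeffs-fromCoeffs bs))

fromCoeffs-coeffs : ∀ p → fromCoeffs (coeffs p) ≡ p
fromCoeffs-coeffs 0p        = refl
fromCoeffs-coeffs (lead cs) rewrite unfold-reverse true cs =
  trans (fromCoeffs-∷ʳ-true (reverse cs)) (cong lead (reverse-involutive cs))

coeffs-injective : ∀ {p q} → coeffs p ≈ coeffs q → p ≡ q
coeffs-injective {p} {q} e =
  trans (sym (fromCoeffs-coeffs p)) (trans (fromCoeffs-cong e) (fromCoeffs-coeffs q))

coeffs-+ : ∀ p q → coeffs (p + q) ≈ addL (coeffs p) (coeffs q)
coeffs-+ p q = coeffs-fromCoeffs (addL (coeffs p) (coeffs q))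

coeffs-* : ∀ p q → coeffs (p * q) ≈ mulL (coeffs p) (coeffs q)
coeffs-* p q = coeffs-fromCoeffs (mulL (coeffs p) (coeffs q))

+-comm : ∀ p q → p + q ≡ q + p
+-comm p q = coeffs-injective
  (≈-trans (coeffs-+ p q) (≈-trans (addL-comm (coeffs p) (coeffs q)) (≈-sym (coeffs-+ q p))))

+-assoc : ∀ p q r → (p + q) + r ≡ p + (q + r)
+-assoc p q r = coeffs-injective (begin
  coeffs ((p + q) + r)                          ≈⟨ coeffs-+ (p + q) r ⟩
  addL (coeffs (p + q)) (coeffs r)              ≈⟨ addL-cong (coeffs-+ p q) ≈-refl ⟩
  addL (addL (coeffs p) (coeffs q)) (coeffs r)  ≈⟨ addL-assoc (coeffs p) (coeffs q) (coeffs r) ⟩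
  addL (coeffs p) (addL (coeffs q) (coeffs r))  ≈⟨ addL-cong ≈-refl (coeffs-+ q r) ⟨
  addL (coeffs p) (coeffs (q + r))              ≈⟨ coeffs-+ p (q + r) ⟨
  coeffs (p + (q + r))                          ∎)
  where open SetoidReasoning ≈-setoid

+-identityˡ : ∀ p → 0p + p ≡ p
+-identityˡ = fromCoeffs-coeffs

+-identityʳ : ∀ p → p + 0p ≡ p
+-identityʳ p = trans (+-comm p 0p) (+-identityˡ p)

x+x≡0 : ∀ p → p + p ≡ 0p
x+x≡0 p = coeffs-injective (≈-trans (coeffs-+ p p) (addL-self (coeffs p)))

*-comm : ∀ p q → p * q ≡ q * p
*-comm p q = coeffs-injective
  (≈-trans (coeffs-* p q) (≈-trans (mulL-comm (coeffs p) (coeffs q)) (≈-sym (coeffs-* q p))))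

*-assoc : ∀ p q r → (p * q) * r ≡ p * (q * r)
*-assoc p q r = coeffs-injective (begin
  coeffs ((p * q) * r)                          ≈⟨ coeffs-* (p * q) r ⟩
  mulL (coeffs (p * q)) (coeffs r)              ≈⟨ mulL-congˡ (coeffs r) (coeffs-* p q) ⟩
  mulL (mulL (coeffs p) (coeffs q)) (coeffs r)  ≈⟨ mulL-assoc (coeffs p) (coeffs q) (coeffs r) ⟩
  mulL (coeffs p) (mulL (coeffs q) (coeffs r))  ≈⟨ mulL-congʳ (coeffs p) (coeffs-* q r) ⟨
  mulL (coeffs p) (coeffs (q * r))              ≈⟨ coeffs-* p (q * r) ⟨
  coeffs (p * (q * r))                          ∎)
  where open SetoidReasoning ≈-setoid

*-identityˡ : ∀ p → 1p * p ≡ p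
*-identityˡ p = coeffs-injective (≈-trans (coeffs-* 1p p) (mulL-identityˡ (coeffs p)))

*-identityʳ : ∀ p → p * 1p ≡ p
*-identityʳ p = trans (*-comm p 1p) (*-identityˡ p)

*-zeroˡ : ∀ p → 0p * p ≡ 0p
*-zeroˡ p = refl

*-zeroʳ : ∀ p → p * 0p ≡ 0p
*-zeroʳ p = *-comm p 0p

*-distribʳ-+ : ∀ p q r → (p + q) * r ≡ p * r + q * r
*-distribʳ-+ p q r = coeffs-injective (begin
  coeffs ((p + q) * r)                                  ≈⟨ coeffs-* (p + q) r ⟩
  mulL (coeffs (p + q)) (coeffs r)                      ≈⟨ mulL-congˡ (coeffs r) (coeffs-+ p q) ⟩
  mulL (addL (coeffs p) (coeffs q)) (coeffs r)          ≈⟨ mulL-distribʳ (coeffs p) (coeffs q) (coeffs r) ⟩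
  addL (mulL (coeffs p) (coeffs r)) (mulL (coeffs q) (coeffs r))
    ≈⟨ addL-cong (coeffs-* p r) (coeffs-* q r) ⟨
  addL (coeffs (p * r)) (coeffs (q * r))                ≈⟨ coeffs-+ (p * r) (q * r) ⟨
  coeffs (p * r + q * r)                                ∎)
  where open SetoidReasoning ≈-setoid

*-distribˡ-+ : ∀ p q r → p * (q + r) ≡ p * q + p * r
*-distribˡ-+ p q r =
  trans (*-comm p (q + r)) (trans (*-distribʳ-+ q r p) (cong₂ _+_ (*-comm q p) (*-comm r p)))

+-*-isCommutativeSemiring : IsCommutativeSemiring _≡_ _+_ _*_ 0p 1p
+-*-isCommutativeSemiring = record
  { isSemiring = record
    { isSemiringWithoutAnnihilatingZero = record
      { +-isCommutativeMonoid = record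
        { isMonoid = record
          { isSemigroup = record
            { isMagma = record { isEquivalence = isEquivalence ; ∙-cong = cong₂ _+_ }
            ; assoc = +-assoc }
          ; identity = +-identityˡ , +-identityʳ }
        ; comm = +-comm }
      ; *-cong = cong₂ _*_
      ; *-assoc = *-assoc
      ; *-identity = *-identityˡ , *-identityʳ
      ; distrib = *-distribˡ-+ , λ r p q → *-distribʳ-+ p q r }
    ; zero = *-zeroˡ , *-zeroʳ }
  ; *-comm = *-comm }

+-*-commutativeSemiring : CommutativeSemiring _ _
+-*-commutativeSemiring = record { isCommutativeSemiring = +-*-isCommutativeSemiring }

polyRing : AlmostCommutativeRing _ _
polyRing = fromCommutativeSemiring +-*-commutativeSemiring (λ _ → nothing)

length-scale : ∀ b bs → length (scale b bs) ≤ length bs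
length-scale true  bs = ℕ.≤-refl
length-scale false bs = z≤n

length-addL : ∀ as bs → length as ≤ length bs → length (addL as bs) ≡ length bs
length-addL []       bs       _         = refl
length-addL (a ∷ as) (b ∷ bs) (s≤s le) = cong suc (length-addL as bs le)

addL-∷ʳ : ∀ as bs c → length as ≤ length bs → addL as (bs ∷ʳ c) ≡ addL as bs ∷ʳ c
addL-∷ʳ []       bs       c _        = refl
addL-∷ʳ (a ∷ as) (b ∷ bs) c (s≤s le) = cong ((a xor b) ∷_) (addL-∷ʳ as bs c le)

mulL-∷ʳ-true : ∀ as bs → ∃ λ cs → mulL (as ∷ʳ true) (bs ∷ʳ true) ≡ cs ∷ʳ true × length cs ≡ length as +ℕ length bs
mulL-∷ʳ-true []       []       = [] , refl , refl
mulL-∷ʳ-true []       (b ∷ bs) = b ∷ bs , cong₂ _∷_ (xor-identityʳ b) (addL-identityʳ (bs ∷ʳ true)) , refl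
mulL-∷ʳ-true (a ∷ as) bs with mulL-∷ʳ-true as bs
... | cs , eq , len =
  addL (scale a (bs ∷ʳ true)) (false ∷ cs) ,
  trans (cong (λ ds → addL (scale a (bs ∷ʳ true)) (false ∷ ds)) eq) (addL-∷ʳ (scale a (bs ∷ʳ true)) (false ∷ cs) true short) ,
  trans (length-addL (scale a (bs ∷ʳ true)) (false ∷ cs) short) (cong suc len)
  where
  short : length (scale a (bs ∷ʳ true)) ≤ length (false ∷ cs)
  short = begin
    length (scale a (bs ∷ʳ true))  ≤⟨ length-scale a (bs ∷ʳ true) ⟩
    length (bs ∷ʳ true)            ≡⟨ length-++ bs ⟩
    length bs +ℕ 1                 ≡⟨ ℕ.+-comm (length bs) 1 ⟩
    suc (length bs)                ≤⟨ s≤s (ℕ.m≤n+m (length bs) (length as)) ⟩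
    suc (length as +ℕ length bs)   ≡⟨ cong suc len ⟨
    length (false ∷ cs)            ∎
    where open ℕ.≤-Reasoning

coeffs-lead : ∀ cs → coeffs (lead cs) ≡ reverse cs ∷ʳ true
coeffs-lead cs = unfold-reverse true cs

lead-*-lead : ∀ cs ds → ∃ λ es → lead cs * lead ds ≡ lead es × length es ≡ length cs +ℕ length ds
lead-*-lead cs ds with mulL-∷ʳ-true (reverse cs) (reverse ds)
... | es , eq , len =
  reverse es ,
  trans (cong₂ (λ as bs → fromCoeffs (mulL as bs)) (coeffs-lead cs) (coeffs-lead ds))
        (trans (cong fromCoeffs eq) (fromCoeffs-∷ʳ-true es)) ,
  trans (length-reverse es) (trans len (cong₂ _+ℕ_ (length-reverse cs) (length-reverse ds)))

*-≢0 : ∀ {p q} → p ≢ 0p → q ≢ 0p → p * q ≢ 0p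
*-≢0 {0p}      {q}       p≢0 q≢0 = ⊥-elim (p≢0 refl)
*-≢0 {lead cs} {0p}      p≢0 q≢0 = ⊥-elim (q≢0 refl)
*-≢0 {lead cs} {lead ds} p≢0 q≢0 pq≡0 with lead-*-lead cs ds
... | es , eq , _ with trans (sym eq) pq≡0
... | ()

deg-* : ∀ {p q} → p ≢ 0p → q ≢ 0p → deg (p * q) ≡ deg p +ℕ deg q
deg-* {0p}      {q}       p≢0 q≢0 = ⊥-elim (p≢0 refl)
deg-* {lead cs} {0p}      p≢0 q≢0 = ⊥-elim (q≢0 refl)
deg-* {lead cs} {lead ds} p≢0 q≢0 with lead-*-lead cs ds
... | es , eq , len = trans (cong deg eq) len

deg≡0⇒≡1 : ∀ {p} → p ≢ 0p → deg p ≡ 0 → p ≡ 1p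
deg≡0⇒≡1 {0p}      p≢0 _ = ⊥-elim (p≢0 refl)
deg≡0⇒≡1 {lead []} p≢0 _ = refl

x+y≡0⇒x≡y : ∀ {p q} → p + q ≡ 0p → p ≡ q
x+y≡0⇒x≡y {p} {q} p+q≡0 = begin
  p              ≡⟨ +-identityʳ p ⟨
  p + 0p         ≡⟨ cong (p +_) (x+x≡0 q) ⟨
  p + (q + q)    ≡⟨ +-assoc p q q ⟨
  (p + q) + q    ≡⟨ cong (_+ q) p+q≡0 ⟩
  0p + q         ≡⟨ +-identityˡ q ⟩
  q              ∎
  where open ≡-Reasoning

x+y+y≡x : ∀ p q → (p + q) + q ≡ p
x+y+y≡x p q = trans (+-assoc p q q) (trans (cong (p +_) (x+x≡0 q)) (+-identityʳ p))

*-cancelˡ : ∀ {p q r} → p ≢ 0p → p * q ≡ p * r → q ≡ r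
*-cancelˡ {p} {q} {r} p≢0 eq with q + r ≟ 0p
... | yes q+r≡0 = x+y≡0⇒x≡y q+r≡0
... | no  q+r≢0 = ⊥-elim (*-≢0 {p} {q + r} p≢0 q+r≢0 (begin
  p * (q + r)      ≡⟨ *-distribˡ-+ p q r ⟩
  p * q + p * r    ≡⟨ cong (_+ p * r) eq ⟩
  p * r + p * r    ≡⟨ x+x≡0 (p * r) ⟩
  0p               ∎))
  where open ≡-Reasoning

∣-refl : ∀ p → p ∣ p
∣-refl p = 1p , *-identityʳ p

∣0 : ∀ p → p ∣ 0p
∣0 p = 0p , *-zeroʳ p

∣-trans : ∀ {p q r} → p ∣ q → q ∣ r → p ∣ r
∣-trans {p} (c , pc≡q) (d , qd≡r) = c * d , trans (sym (*-assoc p c d)) (trans (cong (_* d) pc≡q) qd≡r)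

∣-*ʳ : ∀ {p q} r → p ∣ q → p ∣ q * r
∣-*ʳ {p} r (c , pc≡q) = c * r , trans (sym (*-assoc p c r)) (cong (_* r) pc≡q)

∣-*ˡ : ∀ {p q} r → p ∣ q → p ∣ r * q
∣-*ˡ {p} {q} r p∣q = subst (p ∣_) (*-comm q r) (∣-*ʳ {p} r p∣q)

∣-+ : ∀ {p q r} → p ∣ q → p ∣ r → p ∣ q + r
∣-+ {p} (c , pc≡q) (d , pd≡r) = c + d , trans (*-distribˡ-+ p c d) (cong₂ _+_ pc≡q pd≡r)

∣-*-self : ∀ p q → p ∣ p * q
∣-*-self p q = q , refl

module _ {d c a : Poly} (dc≡a : d * c ≡ a) (a≢0 : a ≢ 0p) where

  divisor-≢0 : d ≢ 0p
  divisor-≢0 refl = a≢0 (sym dc≡a)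

  cofactor-≢0 : c ≢ 0p
  cofactor-≢0 refl = a≢0 (trans (sym dc≡a) (*-zeroʳ d))

  deg-divisor-≡ : deg d +ℕ deg c ≡ deg a
  deg-divisor-≡ = trans (sym (deg-* divisor-≢0 cofactor-≢0)) (cong deg dc≡a)

  deg-divisor-≤ : deg d ≤ deg a
  deg-divisor-≤ = subst (deg d ≤_) deg-divisor-≡ (ℕ.m≤m+n (deg d) (deg c))

  deg-cofactor-≤ : deg c ≤ deg a
  deg-cofactor-≤ = subst (deg c ≤_) deg-divisor-≡ (ℕ.m≤n+m (deg c) (deg d))

  deg-divisor-< : c ≢ 1p → deg d < deg a
  deg-divisor-< c≢1 = subst (deg d <_) deg-divisor-≡
    (ℕ.≤-trans (ℕ.≤-reflexive (ℕ.+-comm 1 (deg d))) (ℕ.+-monoʳ-≤ (deg d) 0<deg-c))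
    where
    0<deg-c : 0 < deg c
    0<deg-c with deg c in eq
    ... | zero  = ⊥-elim (c≢1 (deg≡0⇒≡1 cofactor-≢0 eq))
    ... | suc _ = s≤s z≤n

*≡1⇒≡1 : ∀ {p q} → p * q ≡ 1p → p ≡ 1p
*≡1⇒≡1 {p} {q} pq≡1 = deg≡0⇒≡1 (divisor-≢0 {p} {q} pq≡1 λ ()) (ℕ.m+n≡0⇒m≡0 _ (deg-divisor-≡ {p} {q} pq≡1 λ ()))

∣-antisym : ∀ {p q} → q ≢ 0p → p ∣ q → q ∣ p → p ≡ q
∣-antisym {p} {q} q≢0 (c , pc≡q) (d , qd≡p) = trans (sym qd≡p) (trans (cong (q *_) d≡1) (*-identityʳ q))
  where
  d≡1 : d ≡ 1p
  d≡1 = *≡1⇒≡1 {d} {c} (*-cancelˡ {q} {d * c} {1p} q≢0 (begin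
    q * (d * c)   ≡⟨ *-assoc q d c ⟨
    (q * d) * c   ≡⟨ cong (_* c) qd≡p ⟩
    p * c         ≡⟨ pc≡q ⟩
    q             ≡⟨ *-identityʳ q ⟨
    q * 1p        ∎))
    where open ≡-Reasoning

-- Division with remainder and Bézout's identity

X : Poly
X = lead (false ∷ [])

X^_ : ℕ → Poly
X^ zero  = 1p
X^ suc k = X * X^ k

X*lead : ∀ cs → X * lead cs ≡ lead (cs ∷ʳ false)
X*lead cs = begin
  fromCoeffs (mulL (false ∷ true ∷ []) (coeffs (lead cs)))
    ≡⟨ cong (λ as → fromCoeffs (mulL (false ∷ true ∷ []) as)) (coeffs-lead cs) ⟩
  fromCoeffs (false ∷ addL (reverse cs ∷ʳ true) (false ∷ []))
    ≡⟨ cong (λ as → fromCoeffs (false ∷ as)) (addL-false (reverse cs)) ⟩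
  fromCoeffs ((false ∷ reverse cs) ∷ʳ true)
    ≡⟨ fromCoeffs-∷ʳ-true (false ∷ reverse cs) ⟩
  lead (reverse (false ∷ reverse cs))
    ≡⟨ cong lead (trans (unfold-reverse false (reverse cs)) (cong (_∷ʳ false) (reverse-involutive cs))) ⟩
  lead (cs ∷ʳ false) ∎
  where
  open ≡-Reasoning
  addL-false : ∀ as → addL (as ∷ʳ true) (false ∷ []) ≡ as ∷ʳ true
  addL-false []       = refl
  addL-false (a ∷ as) = cong₂ _∷_ (xor-identityʳ a) (addL-identityʳ (as ∷ʳ true))

X^*lead : ∀ k cs → X^ k * lead cs ≡ lead (cs ++ replicate k false)
X^*lead zero    cs = trans (*-identityˡ (lead cs)) (cong lead (sym (++-identityʳ cs)))
X^*lead (suc k) cs = begin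
  (X * X^ k) * lead cs                    ≡⟨ *-assoc X (X^ k) (lead cs) ⟩
  X * (X^ k * lead cs)                    ≡⟨ cong (X *_) (X^*lead k cs) ⟩
  X * lead (cs ++ replicate k false)      ≡⟨ X*lead (cs ++ replicate k false) ⟩
  lead ((cs ++ replicate k false) ∷ʳ false) ≡⟨ cong lead (trans (++-assoc cs _ _) (cong (cs ++_) (replicate-∷ʳ k))) ⟩
  lead (cs ++ replicate (suc k) false)    ∎
  where
  open ≡-Reasoning
  replicate-∷ʳ : ∀ k → replicate k false ∷ʳ false ≡ false ∷ replicate k false
  replicate-∷ʳ zero    = refl
  replicate-∷ʳ (suc k) = cong (false ∷_) (replicate-∷ʳ k)

fromCoeffs-deg : ∀ bs → fromCoeffs bs ≡ 0p ⊎ deg (fromCoeffs bs) < length bs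
fromCoeffs-deg []       = inj₁ refl
fromCoeffs-deg (b ∷ bs) rewrite fromCoeffs-∷ b bs with fromCoeffs bs | fromCoeffs-deg bs
... | 0p      | _       = consP-0p b
  where
  consP-0p : ∀ b → consP b 0p ≡ 0p ⊎ deg (consP b 0p) < suc (length bs)
  consP-0p true  = inj₂ (s≤s z≤n)
  consP-0p false = inj₁ refl
... | lead cs | inj₂ lt =
  inj₂ (subst (_< suc (length bs)) (sym (trans (length-++ cs) (ℕ.+-comm (length cs) 1))) (s≤s lt))

addL-++ : ∀ as bs cs ds → length as ≡ length bs → addL (as ++ cs) (bs ++ ds) ≡ addL as bs ++ addL cs ds
addL-++ []       []       cs ds _   = refl
addL-++ (a ∷ as) (b ∷ bs) cs ds len = cong ((a xor b) ∷_) (addL-++ as bs cs ds (ℕ.suc-injective len))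

lead+lead : ∀ as bs → length as ≡ length bs → lead as + lead bs ≡ 0p ⊎ deg (lead as + lead bs) < length as
lead+lead as bs len =
  subst (λ p → p ≡ 0p ⊎ deg p < length as) (sym sum-≡)
        (subst (λ n → low ≡ 0p ⊎ deg low < n) len-low (fromCoeffs-deg (addL (reverse as) (reverse bs))))
  where
  low : Poly
  low = fromCoeffs (addL (reverse as) (reverse bs))
  len-rev : length (reverse as) ≡ length (reverse bs)
  len-rev = trans (length-reverse as) (trans len (sym (length-reverse bs)))
  len-low : length (addL (reverse as) (reverse bs)) ≡ length as
  len-low = trans (length-addL (reverse as) (reverse bs) (ℕ.≤-reflexive len-rev))
                  (trans (length-reverse bs) (sym len))
  sum-≡ : lead as + lead bs ≡ fromCoeffs (addL (reverse as) (reverse bs))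
  sum-≡ = begin
    fromCoeffs (addL (coeffs (lead as)) (coeffs (lead bs)))
      ≡⟨ cong₂ (λ cs ds → fromCoeffs (addL cs ds)) (coeffs-lead as) (coeffs-lead bs) ⟩
    fromCoeffs (addL (reverse as ∷ʳ true) (reverse bs ∷ʳ true))
      ≡⟨ cong fromCoeffs (addL-++ (reverse as) (reverse bs) _ _ len-rev) ⟩
    fromCoeffs (addL (reverse as) (reverse bs) ∷ʳ false)
      ≡⟨ fromCoeffs-∷ʳ-false (addL (reverse as) (reverse bs)) ⟩
    fromCoeffs (addL (reverse as) (reverse bs)) ∎
    where open ≡-Reasoning

size : Poly → ℕ
size 0p        = 0
size (lead cs) = suc (length cs)

Reduced : Poly → Poly → Set
Reduced r b = r ≡ 0p ⊎ deg r < deg b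

Reduced⇒size< : ∀ {r b} → b ≢ 0p → Reduced r b → size r < size b
Reduced⇒size< {r}       {0p}      b≢0 _           = ⊥-elim (b≢0 refl)
Reduced⇒size< {.0p}     {lead bs} b≢0 (inj₁ refl) = s≤s z≤n
Reduced⇒size< {0p}      {lead bs} b≢0 (inj₂ _)    = s≤s z≤n
Reduced⇒size< {lead rs} {lead bs} b≢0 (inj₂ lt)   = s≤s lt

cancelLeading : ∀ as bs → length bs ≤ length as →
                size (lead as + X^ (length as ∸ length bs) * lead bs) ≤ length as
cancelLeading as bs bs≤as = subst (λ p → size (lead as + p) ≤ length as) (sym (X^*lead k bs))
  (size≤ (lead+lead as (bs ++ replicate k false) same-length))
  where
  k : ℕ
  k = length as ∸ length bs
  same-length : length as ≡ length (bs ++ replicate k false)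
  same-length = sym (trans (length-++ bs) (trans (cong (length bs +ℕ_) (length-replicate k)) (ℕ.m+[n∸m]≡n bs≤as)))
  size≤ : ∀ {p} → p ≡ 0p ⊎ deg p < length as → size p ≤ length as
  size≤ {.0p}     (inj₁ refl) = z≤n
  size≤ {0p}      (inj₂ _)    = z≤n
  size≤ {lead cs} (inj₂ lt)   = lt

record DivMod (a b : Poly) : Set where
  field
    quotient  : Poly
    remainder : Poly
    division  : a ≡ quotient * b + remainder
    reduced   : Reduced remainder b

divModBounded : ∀ n a b → size a ≤ n → b ≢ 0p → DivMod a b
divModBounded n       0p        b         _        _   = record { quotient = 0p ; remainder = 0p ; division = refl ; reduced = inj₁ refl }
divModBounded n       (lead as) 0p        _        b≢0 = ⊥-elim (b≢0 refl)
divModBounded (suc n) (lead as) (lead bs) (s≤s sz) b≢0 with length as ℕ.<? length bs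
... | yes as<bs = record
  { quotient = 0p ; remainder = lead as ; division = sym (+-identityˡ (lead as)) ; reduced = inj₂ as<bs }
... | no  as≮bs = record
  { quotient = quotient + X^k ; remainder = remainder ; division = division′ ; reduced = reduced }
  where
  X^k : Poly
  X^k = X^ (length as ∸ length bs)
  a′ : Poly
  a′ = lead as + X^k * lead bs
  open DivMod (divModBounded n a′ (lead bs) (ℕ.≤-trans (cancelLeading as bs (ℕ.≮⇒≥ as≮bs)) sz) b≢0)
  division′ : lead as ≡ (quotient + X^k) * lead bs + remainder
  division′ = begin
    lead as                                       ≡⟨ x+y+y≡x (lead as) (X^k * lead bs) ⟨
    a′ + X^k * lead bs                            ≡⟨ cong (_+ X^k * lead bs) division ⟩
    (quotient * lead bs + remainder) + X^k * lead bs ≡⟨ regroup quotient (lead bs) remainder X^k ⟩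
    (quotient + X^k) * lead bs + remainder        ∎
    where
    open ≡-Reasoning
    regroup : ∀ q b r m → (q * b + r) + m * b ≡ (q + m) * b + r
    regroup = solve-∀ polyRing

divMod : ∀ a b → b ≢ 0p → DivMod a b
divMod a b = divModBounded (size a) a b ℕ.≤-refl

record Bézout (a b : Poly) : Set where
  field
    gcd      : Poly
    u v      : Poly
    gcd∣a    : gcd ∣ a
    gcd∣b    : gcd ∣ b
    identity : gcd ≡ u * a + v * b

bézoutBounded : ∀ n a b → size b ≤ n → Bézout a b
bézoutBounded n       a 0p        _        = record
  { gcd = a ; u = 1p ; v = 0p ; gcd∣a = ∣-refl a ; gcd∣b = ∣0 a
  ; identity = sym (trans (+-identityʳ (1p * a)) (*-identityˡ a)) }
bézoutBounded (suc n) a (lead bs) (s≤s sz) = record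
  { gcd = gcd ; u = v ; v = u + v * quotient ; gcd∣a = gcd∣a′ ; gcd∣b = gcd∣a ; identity = identity′ }
  where
  open DivMod (divMod a (lead bs) λ ())
  open Bézout (bézoutBounded n (lead bs) remainder
                 (ℕ.≤-trans (ℕ.≤-pred (Reduced⇒size< {remainder} {lead bs} (λ ()) reduced)) sz))
  gcd∣a′ : gcd ∣ a
  gcd∣a′ = subst (gcd ∣_) (sym division) (∣-+ {gcd} (∣-*ˡ {gcd} quotient gcd∣a) gcd∣b)
  remainder≡ : remainder ≡ a + quotient * lead bs
  remainder≡ = begin
    remainder                                        ≡⟨ x+y+y≡x remainder (quotient * lead bs) ⟨
    (remainder + quotient * lead bs) + quotient * lead bs
      ≡⟨ cong (_+ quotient * lead bs) (trans (+-comm remainder (quotient * lead bs)) (sym division)) ⟩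
    a + quotient * lead bs                           ∎
    where open ≡-Reasoning
  identity′ : gcd ≡ v * a + (u + v * quotient) * lead bs
  identity′ = begin
    gcd                                             ≡⟨ identity ⟩
    u * lead bs + v * remainder                     ≡⟨ cong (λ r → u * lead bs + v * r) remainder≡ ⟩
    u * lead bs + v * (a + quotient * lead bs)      ≡⟨ regroup u (lead bs) v a quotient ⟩
    v * a + (u + v * quotient) * lead bs            ∎
    where
    open ≡-Reasoning
    regroup : ∀ u b v a q → u * b + v * (a + q * b) ≡ v * a + (u + v * q) * b
    regroup = solve-∀ polyRing

bézout : ∀ a b → Bézout a b
bézout a b = bézoutBounded (size b) a b ℕ.≤-refl

bézout⇒∣ : ∀ {a b c} u v → 1p ≡ u * a + v * b → a ∣ b * c → a ∣ c
bézout⇒∣ {a} {b} {c} u v 1≡ua+vb a∣bc = subst (a ∣_) c≡ (∣-+ {a} (∣-*-self a (u * c)) (∣-*ˡ {a} v a∣bc))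
  where
  c≡ : a * (u * c) + v * (b * c) ≡ c
  c≡ = begin
    a * (u * c) + v * (b * c)   ≡⟨ regroup u a v b c ⟩
    (u * a + v * b) * c         ≡⟨ cong (_* c) 1≡ua+vb ⟨
    1p * c                      ≡⟨ *-identityˡ c ⟩
    c                           ∎
    where
    open ≡-Reasoning
    regroup : ∀ u a v b c → a * (u * c) + v * (b * c) ≡ (u * a + v * b) * c
    regroup = solve-∀ polyRing

euclidsLemma : ∀ {p} a b → Irreducible p → p ∣ a * b → p ∣ a ⊎ p ∣ b
euclidsLemma {p} a b (_ , _ , p-irr) p∣ab with bézout p a
... | record { gcd = g ; u = u ; v = v ; gcd∣a = g∣p ; gcd∣b = g∣a ; identity = g≡ } with p-irr g g∣p
...   | inj₁ refl = inj₂ (bézout⇒∣ {p} {a} {b} u v g≡ p∣ab)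
...   | inj₂ refl = inj₁ g∣a

coprime-divisor : ∀ {d a b} → Coprime d b → d ∣ a * b → d ∣ a
coprime-divisor {d} {a} {b} d⊥b d∣ab with bézout d b
... | record { gcd = g ; u = u ; v = v ; gcd∣a = g∣d ; gcd∣b = g∣b ; identity = g≡ } with d⊥b g g∣d g∣b
...   | refl = bézout⇒∣ {d} {b} {a} u v g≡ (subst (d ∣_) (*-comm a b) d∣ab)

module _ {A B : Set} where

  Unique-map⁺-on : ∀ (f : A → B) {xs} → Unique xs →
                   (∀ {x y} → x ∈ xs → y ∈ xs → f x ≡ f y → x ≡ y) → Unique (map f xs)
  Unique-map⁺-on f {[]}     []         _   = []
  Unique-map⁺-on f {x ∷ xs} (x∉ ∷ uxs) inj =
    All.tabulate fresh ∷ Unique-map⁺-on f uxs (λ p q → inj (there p) (there q))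
    where
    fresh : ∀ {z} → z ∈ map f xs → f x ≢ z
    fresh z∈ fx≡z with ∈-map⁻ f z∈
    ... | y , y∈ , refl = All.lookup x∉ y∈ (inj (here refl) (there y∈) fx≡z)

  Unique-concatMap⁺ : ∀ (f : A → List B) {xs} → Unique xs → (∀ x → Unique (f x)) →
                      (∀ {x y z} → x ≢ y → z ∈ f x → z ∈ f y → ⊥) → Unique (concatMap f xs)
  Unique-concatMap⁺ f {[]}     []         _     _        = []
  Unique-concatMap⁺ f {x ∷ xs} (x∉ ∷ uxs) uniqf disjoint =
    Unique.++⁺ (uniqf x) (Unique-concatMap⁺ f uxs uniqf disjoint)
               λ (z∈fx , z∈rest) → apart z∈fx x∉ (∈-concatMap⁻ f z∈rest)
    where
    apart : ∀ {z ys} → z ∈ f x → All (x ≢_) ys → Any (λ y → z ∈ f y) ys → ⊥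
    apart z∈fx (x≢y ∷ _)   (here z∈fy) = disjoint x≢y z∈fx z∈fy
    apart z∈fx (_   ∷ x≢s) (there any) = apart z∈fx x≢s any

module _ {A : Set} where

  ∈-++-widen : ∀ xs {x : A} {ys z} → z ∈ xs ++ ys → z ∈ xs ++ x ∷ ys
  ∈-++-widen xs z∈ with ∈-++⁻ xs z∈
  ... | inj₁ z∈xs = ∈-++⁺ˡ z∈xs
  ... | inj₂ z∈ys = ∈-++⁺ʳ xs (there z∈ys)

  Unique-drop-middle : ∀ xs {x : A} {ys} → Unique (xs ++ x ∷ ys) → Unique (xs ++ ys) × x ∉ xs ++ ys
  Unique-drop-middle []       (x∉ ∷ u) = u , λ x∈ → All.lookup x∉ x∈ refl
  Unique-drop-middle (y ∷ xs) {x} {ys} (y∉ ∷ u) with Unique-drop-middle xs u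
  ... | u′ , x∉ = All.tabulate (λ z∈ → All.lookup y∉ (∈-++-widen xs z∈)) ∷ u′ , x∉′
    where
    x∉′ : x ∉ y ∷ xs ++ ys
    x∉′ (here x≡y) = All.lookup y∉ (∈-++⁺ʳ xs (here refl)) (sym x≡y)
    x∉′ (there x∈) = x∉ x∈

  Unique-⊆-↭ : ∀ {xs ys : List A} → Unique xs → Unique ys →
               (∀ {z} → z ∈ xs → z ∈ ys) → (∀ {z} → z ∈ ys → z ∈ xs) → xs ↭ ys
  Unique-⊆-↭ {[]}     {[]}     _ _ _ _ = ↭-refl
  Unique-⊆-↭ {[]}     {y ∷ ys} _ _ _ ys⊆ with ys⊆ (here refl)
  ... | ()
  Unique-⊆-↭ {x ∷ xs} {ys} (x∉ ∷ uxs) uys xs⊆ ys⊆ with ∈-∃++ (xs⊆ (here refl))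
  ... | as , bs , refl with Unique-drop-middle as uys
  ... | uasbs , x∉asbs = ↭-trans (prep x (Unique-⊆-↭ uxs uasbs ⊆-left ⊆-right)) (↭-sym (↭.shift x as bs))
    where
    ⊆-left : ∀ {z} → z ∈ xs → z ∈ as ++ bs
    ⊆-left z∈ with ∈-++⁻ as (xs⊆ (there z∈))
    ... | inj₁ z∈as         = ∈-++⁺ˡ z∈as
    ... | inj₂ (here z≡x)   = ⊥-elim (All.lookup x∉ z∈ (sym z≡x))
    ... | inj₂ (there z∈bs) = ∈-++⁺ʳ as z∈bs
    ⊆-right : ∀ {z} → z ∈ as ++ bs → z ∈ xs
    ⊆-right z∈ with ys⊆ (∈-++-widen as z∈)
    ... | here refl  = ⊥-elim (x∉asbs z∈)
    ... | there z∈xs = z∈xs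

  any-true⁻ : ∀ (p : A → Bool) xs → any p xs ≡ true → ∃ λ x → x ∈ xs × p x ≡ true
  any-true⁻ p xs eq with find (any⁻ p xs (Equivalence.from T-≡ eq))
  ... | x , x∈ , px = x , x∈ , Equivalence.to T-≡ px

  any-true⁺ : ∀ (p : A → Bool) {xs x} → x ∈ xs → p x ≡ true → any p xs ≡ true
  any-true⁺ p {xs} x∈ px = Equivalence.to T-≡ (any⁺ p (Any.map (λ { refl → Equivalence.from T-≡ px }) x∈))

  all-true⁻ : ∀ (p : A → Bool) {xs x} → all p xs ≡ true → x ∈ xs → p x ≡ true
  all-true⁻ p {y ∷ xs} eq x∈ with p y in py
  all-true⁻ p {y ∷ xs} eq (here refl) | true = py
  all-true⁻ p {y ∷ xs} eq (there x∈)  | true = all-true⁻ p eq x∈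

  all-true⁺ : ∀ (p : A → Bool) xs → (∀ {x} → x ∈ xs → p x ≡ true) → all p xs ≡ true
  all-true⁺ p []       _   = refl
  all-true⁺ p (x ∷ xs) all-p rewrite all-p (here refl) = all-true⁺ p xs (λ x∈ → all-p (there x∈))

∈-allLists : ∀ cs → cs ∈ allLists (length cs)
∈-allLists []           = here refl
∈-allLists (false ∷ cs) = ∈-++⁺ˡ (∈-map⁺ (false ∷_) (∈-allLists cs))
∈-allLists (true ∷ cs)  = ∈-++⁺ʳ (map (false ∷_) (allLists (length cs))) (∈-map⁺ (true ∷_) (∈-allLists cs))

allLists-length : ∀ k {cs} → cs ∈ allLists k → length cs ≡ k
allLists-length zero    (here refl) = refl
allLists-length (suc k) cs∈ with ∈-++⁻ (map (false ∷_) (allLists k)) cs∈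
... | inj₁ cs∈ˡ with ∈-map⁻ (false ∷_) {xs = allLists k} cs∈ˡ
...   | ds , ds∈ , refl = cong suc (allLists-length k ds∈)
allLists-length (suc k) cs∈ | inj₂ cs∈ʳ with ∈-map⁻ (true ∷_) {xs = allLists k} cs∈ʳ
...   | ds , ds∈ , refl = cong suc (allLists-length k ds∈)

allLists-unique : ∀ k → Unique (allLists k)
allLists-unique zero    = [] ∷ []
allLists-unique (suc k) =
  Unique.++⁺ (Unique.map⁺ ∷-injectiveʳ (allLists-unique k)) (Unique.map⁺ ∷-injectiveʳ (allLists-unique k)) disjoint
  where
  disjoint : ∀ {cs} → ¬ (cs ∈ map (false ∷_) (allLists k) × cs ∈ map (true ∷_) (allLists k))
  disjoint (cs∈ˡ , cs∈ʳ) with ∈-map⁻ (false ∷_) {xs = allLists k} cs∈ˡ | ∈-map⁻ (true ∷_) {xs = allLists k} cs∈ʳ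
  ... | _ , _ , refl | _ , _ , ()

lead-injective : ∀ {cs ds} → lead cs ≡ lead ds → cs ≡ ds
lead-injective refl = refl

∈-polysUpTo : ∀ n p → deg p ≤ n → p ∈ polysUpTo n
∈-polysUpTo n 0p        _  = here refl
∈-polysUpTo n (lead cs) le =
  there (∈-concatMap⁺ (λ k → map lead (allLists k)) (lose (∈-upTo⁺ (s≤s le)) (∈-map⁺ lead (∈-allLists cs))))

polysUpTo-unique : ∀ n → Unique (polysUpTo n)
polysUpTo-unique n =
  All.tabulate 0p∉ ∷ Unique-concatMap⁺ ofDegree (Unique.upTo⁺ (suc n))
                        (λ k → Unique.map⁺ lead-injective (allLists-unique k)) disjoint
  where
  ofDegree : ℕ → List Poly
  ofDegree k = map lead (allLists k)
  0p∉ : ∀ {p} → p ∈ concatMap ofDegree (upTo (suc n)) → 0p ≢ p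
  0p∉ p∈ refl = 0p∉ofDegree (∈-concatMap⁻ ofDegree {xs = upTo (suc n)} p∈)
    where
    0p∉ofDegree : ∀ {ks} → Any (λ k → 0p ∈ ofDegree k) ks → ⊥
    0p∉ofDegree {k ∷ _} (here 0p∈) with ∈-map⁻ lead {xs = allLists k} 0p∈
    ... | _ , _ , ()
    0p∉ofDegree (there any) = 0p∉ofDegree any
  disjoint : ∀ {k l p} → k ≢ l → p ∈ ofDegree k → p ∈ ofDegree l → ⊥
  disjoint {k} {l} k≢l p∈k p∈l with ∈-map⁻ lead {xs = allLists k} p∈k | ∈-map⁻ lead {xs = allLists l} p∈l
  ... | cs , cs∈ , refl | ds , ds∈ , eq =
    k≢l (trans (sym (allLists-length k cs∈)) (trans (cong length (lead-injective eq)) (allLists-length l ds∈)))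

∈-divisorPairs⁺ : ∀ {a d c} → a ≢ 0p → d * c ≡ a → (d , c) ∈ divisorPairs a
∈-divisorPairs⁺ {a} {d} {c} a≢0 dc≡a = ∈-filter⁺ (λ dc → proj₁ dc * proj₂ dc ≟ a)
  (∈-cartesianProduct⁺ (∈-polysUpTo (deg a) d (deg-divisor-≤ {d} {c} dc≡a a≢0))
                       (∈-polysUpTo (deg a) c (deg-cofactor-≤ {d} {c} dc≡a a≢0)))
  dc≡a

∈-divisorPairs⁻ : ∀ {a dc} → dc ∈ divisorPairs a → proj₁ dc * proj₂ dc ≡ a
∈-divisorPairs⁻ {a} dc∈ =
  proj₂ (∈-filter⁻ (λ dc → proj₁ dc * proj₂ dc ≟ a) {xs = cartesianProduct (polysUpTo (deg a)) (polysUpTo (deg a))} dc∈)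

divisorPairs-unique : ∀ a → Unique (divisorPairs a)
divisorPairs-unique a = Unique.filter⁺ (λ dc → proj₁ dc * proj₂ dc ≟ a)
  (Unique.cartesianProduct⁺ (polysUpTo-unique (deg a)) (polysUpTo-unique (deg a)))

∈-divisors⁺ : ∀ {a d} → a ≢ 0p → d ∣ a → d ∈ divisors a
∈-divisors⁺ {a} {d} a≢0 (c , dc≡a) = ∈-map⁺ proj₁ (∈-divisorPairs⁺ {a} {d} {c} a≢0 dc≡a)

∈-divisors⁻ : ∀ {a d} → d ∈ divisors a → d ∣ a
∈-divisors⁻ {a} d∈ with ∈-map⁻ proj₁ {xs = divisorPairs a} d∈
... | (d , c) , dc∈ , refl = c , ∈-divisorPairs⁻ {a} dc∈

divisors-unique : ∀ a → a ≢ 0p → Unique (divisors a)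
divisors-unique a a≢0 = Unique-map⁺-on proj₁ (divisorPairs-unique a) same-divisor
  where
  same-divisor : ∀ {x y} → x ∈ divisorPairs a → y ∈ divisorPairs a → proj₁ x ≡ proj₁ y → x ≡ y
  same-divisor {d , c} {.d , c′} x∈ y∈ refl = cong (d ,_)
    (*-cancelˡ (divisor-≢0 {d} {c} (∈-divisorPairs⁻ {a} x∈) a≢0)
               (trans (∈-divisorPairs⁻ {a} x∈) (sym (∈-divisorPairs⁻ {a} y∈))))

==-refl : ∀ p → (p == p) ≡ true
==-refl p with p ≟ p
... | yes _   = refl
... | no  p≢p = ⊥-elim (p≢p refl)

≢⇒==-false : ∀ {p q} → p ≢ q → (p == q) ≡ false
≢⇒==-false {p} {q} p≢q with p ≟ q
... | yes p≡q = ⊥-elim (p≢q p≡q)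
... | no  _   = refl

==-true⇒≡ : ∀ {p q} → (p == q) ≡ true → p ≡ q
==-true⇒≡ {p} {q} eq with p ≟ q
... | yes p≡q = p≡q

==-false⇒≢ : ∀ {p q} → (p == q) ≡ false → p ≢ q
==-false⇒≢ {p} {q} eq with p ≟ q
... | no p≢q = p≢q

∧-true⁻ : ∀ {a b} → a ∧ b ≡ true → a ≡ true × b ≡ true
∧-true⁻ {true} {true} _ = refl , refl

not-true⁻ : ∀ {a} → not a ≡ true → a ≡ false
not-true⁻ {false} _ = refl

∨-true⁻ : ∀ {a b} → a ∨ b ≡ true → a ≡ true ⊎ b ≡ true
∨-true⁻ {true}          _ = inj₁ refl
∨-true⁻ {false} {true}  _ = inj₂ refl

Irreducible⇒irreducibleᵇ : ∀ {p} → Irreducible p → irreducibleᵇ p ≡ true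
Irreducible⇒irreducibleᵇ {p} (p≢0 , p≢1 , p-irr) rewrite ≢⇒==-false p≢0 | ≢⇒==-false p≢1 =
  all-true⁺ _ (divisors p) trivial-divisor
  where
  trivial-divisor : ∀ {d} → d ∈ divisors p → ((d == 1p) ∨ (d == p)) ≡ true
  trivial-divisor {d} d∈ with p-irr d (∈-divisors⁻ {p} d∈)
  ... | inj₁ refl rewrite ==-refl 1p = refl
  ... | inj₂ refl rewrite ==-refl p  = ∨-zeroʳ _

irreducibleᵇ⇒Irreducible : ∀ {p} → irreducibleᵇ p ≡ true → Irreducible p
irreducibleᵇ⇒Irreducible {p} eq with ∧-true⁻ {not (p == 0p)} eq
... | p≢0ᵇ , eq′ with ∧-true⁻ {not (p == 1p)} eq′
... | p≢1ᵇ , allᵇ = p≢0 , ==-false⇒≢ (not-true⁻ p≢1ᵇ) , p-irr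
  where
  p≢0 : p ≢ 0p
  p≢0 = ==-false⇒≢ (not-true⁻ p≢0ᵇ)
  p-irr : ∀ d → d ∣ p → d ≡ 1p ⊎ d ≡ p
  p-irr d d∣p with ∨-true⁻ (all-true⁻ (λ d → (d == 1p) ∨ (d == p)) allᵇ (∈-divisors⁺ {p} {d} p≢0 d∣p))
  ... | inj₁ d≡1 = inj₁ (==-true⇒≡ d≡1)
  ... | inj₂ d≡p = inj₂ (==-true⇒≡ d≡p)

SquareFree⇒squareFreeᵇ : ∀ {s} → SquareFree s → squareFreeᵇ s ≡ true
SquareFree⇒squareFreeᵇ {s} (s≢0 , s-sqf) rewrite ≢⇒==-false s≢0
  with any (λ p → irreducibleᵇ p ∧ any (λ q → q == p * p) (divisors s)) (divisors s) in eq
... | false = refl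
... | true with any-true⁻ _ (divisors s) eq
...   | p , _ , pᵇ with ∧-true⁻ {irreducibleᵇ p} pᵇ
...     | p-irrᵇ , p²ᵇ with any-true⁻ _ (divisors s) p²ᵇ
...       | q , q∈ , q≡p² with ==-true⇒≡ {q} q≡p²
...         | refl = ⊥-elim (s-sqf p (irreducibleᵇ⇒Irreducible p-irrᵇ) (∈-divisors⁻ {s} q∈))

squareFreeᵇ⇒SquareFree : ∀ {s} → squareFreeᵇ s ≡ true → SquareFree s
squareFreeᵇ⇒SquareFree {s} eq with ∧-true⁻ {not (s == 0p)} eq
... | s≢0ᵇ , no-squareᵇ = s≢0 , s-sqf
  where
  s≢0 : s ≢ 0p
  s≢0 = ==-false⇒≢ (not-true⁻ s≢0ᵇ)
  s-sqf : ∀ p → Irreducible p → ¬ (p * p ∣ s)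
  s-sqf p p-irr p²∣s with trans (sym (not-true⁻ no-squareᵇ))
    (any-true⁺ (λ p → irreducibleᵇ p ∧ any (λ q → q == p * p) (divisors s))
      (∈-divisors⁺ {s} {p} s≢0 (∣-trans {p} (∣-*-self p p) p²∣s))
      (cong₂ _∧_ (Irreducible⇒irreducibleᵇ p-irr)
        (any-true⁺ (λ q → q == p * p) (∈-divisors⁺ {s} {p * p} s≢0 p²∣s) (==-refl (p * p)))))
  ... | ()

irreducible-or-properDivisor : ∀ {a} → a ≢ 0p → a ≢ 1p →
                               Irreducible a ⊎ ∃₂ λ d c → d * c ≡ a × d ≢ 1p × c ≢ 1p
irreducible-or-properDivisor {a} a≢0 a≢1 with any (λ d → not (d == 1p) ∧ not (d == a)) (divisors a) in eq
... | false = inj₁ (a≢0 , a≢1 , a-irr)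
  where
  a-irr : ∀ d → d ∣ a → d ≡ 1p ⊎ d ≡ a
  a-irr d d∣a with d ≟ 1p | d ≟ a
  ... | yes d≡1 | _       = inj₁ d≡1
  ... | no  _   | yes d≡a = inj₂ d≡a
  ... | no  d≢1 | no  d≢a with trans (sym eq)
    (any-true⁺ (λ d → not (d == 1p) ∧ not (d == a)) (∈-divisors⁺ {a} {d} a≢0 d∣a)
      (cong₂ (λ x y → not x ∧ not y) (≢⇒==-false d≢1) (≢⇒==-false d≢a)))
  ...   | ()
... | true with any-true⁻ _ (divisors a) eq
...   | d , d∈ , properᵇ with ∧-true⁻ {not (d == 1p)} properᵇ | ∈-divisors⁻ {a} d∈
...     | d≢1ᵇ , d≢aᵇ | c , dc≡a = inj₂ (d , c , dc≡a , ==-false⇒≢ (not-true⁻ d≢1ᵇ) , c≢1)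
  where
  c≢1 : c ≢ 1p
  c≢1 refl = ==-false⇒≢ (not-true⁻ d≢aᵇ) (trans (sym (*-identityʳ d)) dc≡a)

irreducibleFactorBounded : ∀ n a → deg a ≤ n → a ≢ 0p → a ≢ 1p → ∃ λ p → Irreducible p × p ∣ a
irreducibleFactorBounded zero    a deg≤0 a≢0 a≢1 = ⊥-elim (a≢1 (deg≡0⇒≡1 a≢0 (ℕ.n≤0⇒n≡0 deg≤0)))
irreducibleFactorBounded (suc n) a deg≤  a≢0 a≢1 with irreducible-or-properDivisor a≢0 a≢1
... | inj₁ a-irr = a , a-irr , ∣-refl a
... | inj₂ (d , c , dc≡a , d≢1 , c≢1)
  with irreducibleFactorBounded n d (ℕ.≤-pred (ℕ.<-≤-trans (deg-divisor-< {d} {c} dc≡a a≢0 c≢1) deg≤))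
                                (divisor-≢0 {d} {c} dc≡a a≢0) d≢1
...   | p , p-irr , p∣d = p , p-irr , ∣-trans {p} p∣d (c , dc≡a)

irreducibleFactor : ∀ a → a ≢ 0p → a ≢ 1p → ∃ λ p → Irreducible p × p ∣ a
irreducibleFactor a = irreducibleFactorBounded (deg a) a ℕ.≤-refl

open IsCommutativeSemiring +-*-isCommutativeSemiring using (+-isCommutativeMonoid; *-isCommutativeMonoid)

sumP-↭ : ∀ {ps qs} → ps ↭ qs → sumP ps ≡ sumP qs
sumP-↭ ps↭qs = foldr-commMonoid +-isCommutativeMonoid (↭⇒↭ₛ ps↭qs)

prodP-↭ : ∀ {ps qs} → ps ↭ qs → prodP ps ≡ prodP qs
prodP-↭ ps↭qs = foldr-commMonoid *-isCommutativeMonoid (↭⇒↭ₛ ps↭qs)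

module _ {X : Set} where

  sumMap : (X → Poly) → List X → Poly
  sumMap g xs = sumP (map g xs)

  sumMap-++ : ∀ g xs ys → sumMap g (xs ++ ys) ≡ sumMap g xs + sumMap g ys
  sumMap-++ g []       ys = sym (+-identityˡ (sumMap g ys))
  sumMap-++ g (x ∷ xs) ys =
    trans (cong (g x +_) (sumMap-++ g xs ys)) (sym (+-assoc (g x) (sumMap g xs) (sumMap g ys)))

  sumMap-cong : ∀ {g h} xs → (∀ {x} → x ∈ xs → g x ≡ h x) → sumMap g xs ≡ sumMap h xs
  sumMap-cong []       _   = refl
  sumMap-cong (x ∷ xs) g≡h = cong₂ _+_ (g≡h (here refl)) (sumMap-cong xs (λ x∈ → g≡h (there x∈)))

  sumMap-zero : ∀ {g} xs → (∀ {x} → x ∈ xs → g x ≡ 0p) → sumMap g xs ≡ 0p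
  sumMap-zero []       _   = refl
  sumMap-zero (x ∷ xs) g≡0 =
    trans (cong₂ _+_ (g≡0 (here refl)) (sumMap-zero xs (λ x∈ → g≡0 (there x∈)))) (+-identityˡ 0p)

  sumMap-+ : ∀ g h xs → sumMap (λ x → g x + h x) xs ≡ sumMap g xs + sumMap h xs
  sumMap-+ g h []       = refl
  sumMap-+ g h (x ∷ xs) =
    trans (cong ((g x + h x) +_) (sumMap-+ g h xs)) (interchange (g x) (h x) (sumMap g xs) (sumMap h xs))
    where
    interchange : ∀ a b c d → (a + b) + (c + d) ≡ (a + c) + (b + d)
    interchange = solve-∀ polyRing

  sumMap-*ˡ : ∀ c g xs → sumMap (λ x → c * g x) xs ≡ c * sumMap g xs
  sumMap-*ˡ c g []       = sym (*-zeroʳ c)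
  sumMap-*ˡ c g (x ∷ xs) =
    trans (cong (c * g x +_) (sumMap-*ˡ c g xs)) (sym (*-distribˡ-+ c (g x) (sumMap g xs)))

  sumMap-filter : ∀ {ℓ} {P : Pred X ℓ} (P? : Decidable P) g xs →
                  sumMap g (filter P? xs) ≡ sumMap (λ x → if does (P? x) then g x else 0p) xs
  sumMap-filter P? g []       = refl
  sumMap-filter P? g (x ∷ xs) with does (P? x)
  ... | true  = cong (g x +_) (sumMap-filter P? g xs)
  ... | false = trans (sumMap-filter P? g xs) (sym (+-identityˡ _))

  sumMap-single : ∀ {g} xs {x} → Unique xs → x ∈ xs → (∀ {y} → y ∈ xs → y ≢ x → g y ≡ 0p) →
                  sumMap g xs ≡ g x
  sumMap-single {g} (y ∷ xs) (y∉ ∷ _) (here refl) others≡0 =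
    trans (cong (g y +_) (sumMap-zero xs λ z∈ → others≡0 (there z∈) λ z≡y → All.lookup y∉ z∈ (sym z≡y)))
          (+-identityʳ (g y))
  sumMap-single {g} (y ∷ xs) {x} (y∉ ∷ uxs) (there x∈) others≡0 =
    trans (cong₂ _+_ (others≡0 (here refl) λ y≡x → All.lookup y∉ x∈ y≡x)
                     (sumMap-single xs uxs x∈ λ z∈ → others≡0 (there z∈)))
          (+-identityˡ (g x))

  sumMap-↭ : ∀ g {xs ys} → xs ↭ ys → sumMap g xs ≡ sumMap g ys
  sumMap-↭ g xs↭ys = sumP-↭ (↭.map⁺ g xs↭ys)

  sumMap-sameElements : ∀ g {xs ys} → Unique xs → Unique ys →
                        (∀ {z} → z ∈ xs → z ∈ ys) → (∀ {z} → z ∈ ys → z ∈ xs) → sumMap g xs ≡ sumMap g ys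
  sumMap-sameElements g uxs uys xs⊆ys ys⊆xs = sumMap-↭ g (Unique-⊆-↭ uxs uys xs⊆ys ys⊆xs)

sumMap-map : ∀ {X Y : Set} (g : Y → Poly) (f : X → Y) xs → sumMap g (map f xs) ≡ sumMap (λ x → g (f x)) xs
sumMap-map g f xs = cong sumP (sym (map-∘ xs))

sumMap-cartesianProduct : ∀ {X Y : Set} (g : X → Poly) (h : Y → Poly) xs ys →
  sumMap (λ xy → g (proj₁ xy) * h (proj₂ xy)) (cartesianProduct xs ys) ≡ sumMap g xs * sumMap h ys
sumMap-cartesianProduct         g h []       ys = refl
sumMap-cartesianProduct {X} {Y} g h (x ∷ xs) ys = begin
  sumMap gh (map (x ,_) ys ++ cartesianProduct xs ys)
    ≡⟨ sumMap-++ gh (map (x ,_) ys) (cartesianProduct xs ys) ⟩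
  sumMap gh (map (x ,_) ys) + sumMap gh (cartesianProduct xs ys)
    ≡⟨ cong₂ _+_ (trans (sumMap-map gh (x ,_) ys) (sumMap-*ˡ (g x) h ys)) (sumMap-cartesianProduct g h xs ys) ⟩
  g x * sumMap h ys + sumMap g xs * sumMap h ys
    ≡⟨ *-distribʳ-+ (g x) (sumMap g xs) (sumMap h ys) ⟨
  (g x + sumMap g xs) * sumMap h ys ∎
  where
  open ≡-Reasoning
  gh : X × Y → Poly
  gh xy = g (proj₁ xy) * h (proj₂ xy)

-- Divisors of a product of coprime polynomials

Coprime-sym : ∀ {a b} → Coprime a b → Coprime b a
Coprime-sym a⊥b e e∣b e∣a = a⊥b e e∣a e∣b

Coprime-∣ : ∀ {a b d₁ d₂} → Coprime a b → d₁ ∣ a → d₂ ∣ b → Coprime d₁ d₂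
Coprime-∣ {a} {b} {d₁} {d₂} a⊥b d₁∣a d₂∣b e e∣d₁ e∣d₂ =
  a⊥b e (∣-trans {e} {d₁} {a} e∣d₁ d₁∣a) (∣-trans {e} {d₂} {b} e∣d₂ d₂∣b)

-- gcd(d, a) * gcd(d, b) is the required factorization.
∣-*-coprime-split : ∀ {a b d} → a * b ≢ 0p → Coprime a b → d ∣ a * b →
                    ∃₂ λ d₁ d₂ → d₁ ∣ a × d₂ ∣ b × d₁ * d₂ ≡ d
∣-*-coprime-split {a} {b} {d} ab≢0 a⊥b (e , de≡ab) = g₁ , g₂ , g₁∣a , g₂∣b , ∣-antisym d≢0 g₁g₂∣d d∣g₁g₂
  where
  open Bézout (bézout d a) renaming (gcd to g₁; u to u₁; v to v₁; gcd∣a to g₁∣d; gcd∣b to g₁∣a; identity to g₁≡)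
  open Bézout (bézout d b) renaming (gcd to g₂; u to u₂; v to v₂; gcd∣a to g₂∣d; gcd∣b to g₂∣b; identity to g₂≡)
  d≢0 : d ≢ 0p
  d≢0 = divisor-≢0 {d} {e} de≡ab ab≢0
  g₁g₂∣d : g₁ * g₂ ∣ d
  g₁g₂∣d with g₁∣d
  ... | k , g₁k≡d with coprime-divisor {g₂} {k} {g₁} (Coprime-∣ {b} {a} (Coprime-sym {a} a⊥b) g₂∣b g₁∣a)
                         (subst (g₂ ∣_) (trans (sym g₁k≡d) (*-comm g₁ k)) g₂∣d)
  ...   | l , g₂l≡k = l , trans (*-assoc g₁ g₂ l) (trans (cong (g₁ *_) g₂l≡k) g₁k≡d)
  expand : g₁ * g₂ ≡ d * (u₁ * (u₂ * d + v₂ * b) + v₁ * a * u₂) + (v₁ * v₂) * (a * b)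
  expand = trans (cong₂ _*_ g₁≡ g₂≡) (regroup u₁ d v₁ a u₂ v₂ b)
    where
    regroup : ∀ u₁ d v₁ a u₂ v₂ b → (u₁ * d + v₁ * a) * (u₂ * d + v₂ * b) ≡
                                   d * (u₁ * (u₂ * d + v₂ * b) + v₁ * a * u₂) + (v₁ * v₂) * (a * b)
    regroup = solve-∀ polyRing
  d∣g₁g₂ : d ∣ g₁ * g₂
  d∣g₁g₂ = subst (d ∣_) (sym expand)
    (∣-+ {d} (∣-*-self d (u₁ * (u₂ * d + v₂ * b) + v₁ * a * u₂)) (∣-*ˡ {d} (v₁ * v₂) (e , de≡ab)))

mulPairs : (Poly × Poly) × (Poly × Poly) → Poly × Poly
mulPairs ((d₁ , c₁) , (d₂ , c₂)) = d₁ * d₂ , c₁ * c₂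

module _ {a b : Poly} (a≢0 : a ≢ 0p) (b≢0 : b ≢ 0p) (a⊥b : Coprime a b) where

  private
    pairs : List ((Poly × Poly) × (Poly × Poly))
    pairs = cartesianProduct (divisorPairs a) (divisorPairs b)

    ab≢0 : a * b ≢ 0p
    ab≢0 = *-≢0 {a} {b} a≢0 b≢0

    interchange : ∀ p q r s → (p * q) * (r * s) ≡ (p * r) * (q * s)
    interchange = solve-∀ polyRing

  mulPairs-∈ : ∀ {x} → x ∈ pairs → mulPairs x ∈ divisorPairs (a * b)
  mulPairs-∈ {(d₁ , c₁) , (d₂ , c₂)} x∈ with ∈-cartesianProduct⁻ (divisorPairs a) (divisorPairs b) x∈
  ... | dc₁∈ , dc₂∈ = ∈-divisorPairs⁺ {a * b} {d₁ * d₂} {c₁ * c₂} ab≢0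
    (trans (interchange d₁ d₂ c₁ c₂) (cong₂ _*_ (∈-divisorPairs⁻ {a} dc₁∈) (∈-divisorPairs⁻ {b} dc₂∈)))

  mulPairs-injective : ∀ {x y} → x ∈ pairs → y ∈ pairs → mulPairs x ≡ mulPairs y → x ≡ y
  mulPairs-injective {(d₁ , c₁) , (d₂ , c₂)} {(d₁′ , c₁′) , (d₂′ , c₂′)} x∈ y∈ eq
    with ∈-cartesianProduct⁻ (divisorPairs a) (divisorPairs b) x∈
       | ∈-cartesianProduct⁻ (divisorPairs a) (divisorPairs b) y∈
  ... | dc₁∈ , dc₂∈ | dc₁′∈ , dc₂′∈ = cong₂ _,_ (cong₂ _,_ d₁≡ c₁≡) (cong₂ _,_ d₂≡ c₂≡)
    where
    e₁ : d₁ * c₁ ≡ a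
    e₁ = ∈-divisorPairs⁻ {a} dc₁∈
    e₂ : d₂ * c₂ ≡ b
    e₂ = ∈-divisorPairs⁻ {b} dc₂∈
    e₁′ : d₁′ * c₁′ ≡ a
    e₁′ = ∈-divisorPairs⁻ {a} dc₁′∈
    e₂′ : d₂′ * c₂′ ≡ b
    e₂′ = ∈-divisorPairs⁻ {b} dc₂′∈
    d₁≢0 : d₁ ≢ 0p
    d₁≢0 = divisor-≢0 {d₁} {c₁} e₁ a≢0
    d₂≢0 : d₂ ≢ 0p
    d₂≢0 = divisor-≢0 {d₂} {c₂} e₂ b≢0
    d₁d₂≡ : d₁ * d₂ ≡ d₁′ * d₂′
    d₁d₂≡ = cong proj₁ eq
    d₁∣d₁′ : d₁ ∣ d₁′
    d₁∣d₁′ = coprime-divisor {d₁} {d₁′} {d₂′} (Coprime-∣ {a} {b} a⊥b (c₁ , e₁) (c₂′ , e₂′)) (d₂ , d₁d₂≡)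
    d₁′∣d₁ : d₁′ ∣ d₁
    d₁′∣d₁ = coprime-divisor {d₁′} {d₁} {d₂} (Coprime-∣ {a} {b} a⊥b (c₁′ , e₁′) (c₂ , e₂)) (d₂′ , sym d₁d₂≡)
    d₁≡ : d₁ ≡ d₁′
    d₁≡ = sym (∣-antisym d₁≢0 d₁′∣d₁ d₁∣d₁′)
    d₂≡ : d₂ ≡ d₂′
    d₂≡ = *-cancelˡ d₁≢0 (trans d₁d₂≡ (cong (_* d₂′) (sym d₁≡)))
    c₁≡ : c₁ ≡ c₁′
    c₁≡ = *-cancelˡ d₁≢0 (trans e₁ (trans (sym e₁′) (cong (_* c₁′) (sym d₁≡))))
    c₂≡ : c₂ ≡ c₂′
    c₂≡ = *-cancelˡ d₂≢0 (trans e₂ (trans (sym e₂′) (cong (_* c₂′) (sym d₂≡))))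

  mulPairs-surjective : ∀ {z} → z ∈ divisorPairs (a * b) → z ∈ map mulPairs pairs
  mulPairs-surjective {d , c} z∈ = fromSplit (∣-*-coprime-split {a} {b} {d} ab≢0 a⊥b (c , dc≡ab))
    where
    dc≡ab : d * c ≡ a * b
    dc≡ab = ∈-divisorPairs⁻ {a * b} z∈
    fromSplit : (∃₂ λ d₁ d₂ → d₁ ∣ a × d₂ ∣ b × d₁ * d₂ ≡ d) → (d , c) ∈ map mulPairs pairs
    fromSplit (d₁ , d₂ , (c₁ , d₁c₁≡a) , (c₂ , d₂c₂≡b) , d₁d₂≡d) =
      subst (_∈ map mulPairs pairs) (cong₂ _,_ d₁d₂≡d (sym c≡))
        (∈-map⁺ mulPairs (∈-cartesianProduct⁺ (∈-divisorPairs⁺ {a} {d₁} {c₁} a≢0 d₁c₁≡a)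
                                              (∈-divisorPairs⁺ {b} {d₂} {c₂} b≢0 d₂c₂≡b)))
      where
      c≡ : c ≡ c₁ * c₂
      c≡ = *-cancelˡ {d} {c} {c₁ * c₂} (divisor-≢0 {d} {c} dc≡ab ab≢0) (begin
        d * c                    ≡⟨ dc≡ab ⟩
        a * b                    ≡⟨ cong₂ _*_ d₁c₁≡a d₂c₂≡b ⟨
        (d₁ * c₁) * (d₂ * c₂)    ≡⟨ interchange d₁ c₁ d₂ c₂ ⟩
        (d₁ * d₂) * (c₁ * c₂)    ≡⟨ cong (_* (c₁ * c₂)) d₁d₂≡d ⟩
        d * (c₁ * c₂)            ∎)
        where open ≡-Reasoning

  sumMap-divisorPairs-* : ∀ w → sumMap w (divisorPairs (a * b)) ≡ sumMap (λ x → w (mulPairs x)) pairs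
  sumMap-divisorPairs-* w = trans
    (sumMap-sameElements w (divisorPairs-unique (a * b))
      (Unique-map⁺-on mulPairs (Unique.cartesianProduct⁺ (divisorPairs-unique a) (divisorPairs-unique b)) mulPairs-injective)
      mulPairs-surjective image⊆)
    (sumMap-map w mulPairs pairs)
    where
    image⊆ : ∀ {z} → z ∈ map mulPairs pairs → z ∈ divisorPairs (a * b)
    image⊆ z∈ with ∈-map⁻ mulPairs z∈
    ... | x , x∈ , refl = mulPairs-∈ x∈

divisorSum : (Poly × Poly → Poly) → Poly → Poly
divisorSum w a = sumMap w (divisorPairs a)

MultiplicativeOnPairs : (Poly × Poly → Poly) → Set
MultiplicativeOnPairs w = ∀ d₁ c₁ d₂ c₂ → d₁ * c₁ ≢ 0p → d₂ * c₂ ≢ 0p → Coprime (d₁ * c₁) (d₂ * c₂) →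
                          w (d₁ * d₂ , c₁ * c₂) ≡ w (d₁ , c₁) * w (d₂ , c₂)

divisorSum-multiplicative : ∀ w → MultiplicativeOnPairs w → Multiplicative (divisorSum w)
divisorSum-multiplicative w w-mult a b a≢0 b≢0 a⊥b = begin
  divisorSum w (a * b)                                   ≡⟨ sumMap-divisorPairs-* a≢0 b≢0 a⊥b w ⟩
  sumMap (λ x → w (mulPairs x)) pairs                    ≡⟨ sumMap-cong pairs split ⟩
  sumMap (λ x → w (proj₁ x) * w (proj₂ x)) pairs         ≡⟨ sumMap-cartesianProduct w w (divisorPairs a) (divisorPairs b) ⟩
  divisorSum w a * divisorSum w b                        ∎
  where
  open ≡-Reasoning
  pairs : List ((Poly × Poly) × (Poly × Poly))
  pairs = cartesianProduct (divisorPairs a) (divisorPairs b)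
  split : ∀ {x} → x ∈ pairs → w (mulPairs x) ≡ w (proj₁ x) * w (proj₂ x)
  split {(d₁ , c₁) , (d₂ , c₂)} x∈ with ∈-cartesianProduct⁻ (divisorPairs a) (divisorPairs b) x∈
  ... | dc₁∈ , dc₂∈ with ∈-divisorPairs⁻ {a} dc₁∈ | ∈-divisorPairs⁻ {b} dc₂∈
  ...   | refl | refl = w-mult d₁ c₁ d₂ c₂ a≢0 b≢0 a⊥b

σ-multiplicative : Multiplicative σ
σ-multiplicative = divisorSum-multiplicative proj₁ λ _ _ _ _ _ _ _ → refl

irreducible-∣-irreducible : ∀ {p q} → Irreducible p → Irreducible q → q ∣ p → q ≡ p
irreducible-∣-irreducible (_ , _ , p-irr) (_ , q≢1 , _) q∣p with p-irr _ q∣p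
... | inj₁ q≡1 = ⊥-elim (q≢1 q≡1)
... | inj₂ q≡p = q≡p

irreducible-∣-square : ∀ {q a} → Irreducible q → q ∣ a * a → q ∣ a
irreducible-∣-square {q} {a} q-irr q∣a² with euclidsLemma {q} a a q-irr q∣a²
... | inj₁ q∣a = q∣a
... | inj₂ q∣a = q∣a

square-≢0 : ∀ {p} → p ≢ 0p → p * p ≢ 0p
square-≢0 {p} p≢0 = *-≢0 {p} {p} p≢0 p≢0

∤⇒Coprime-square : ∀ {p a} → Irreducible p → ¬ (p ∣ a) → Coprime (p * p) a
∤⇒Coprime-square {p} {a} p-irr@(p≢0 , _) p∤a e e∣p² e∣a with e ≟ 1p
... | yes e≡1 = e≡1
... | no  e≢1 with irreducibleFactor e (divisor-≢0 {e} {proj₁ e∣p²} (proj₂ e∣p²) (square-≢0 {p} p≢0)) e≢1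
...   | q , q-irr , q∣e = ⊥-elim (p∤a (subst (_∣ a) q≡p (∣-trans {q} q∣e e∣a)))
  where
  q≡p : q ≡ p
  q≡p = irreducible-∣-irreducible p-irr q-irr (irreducible-∣-square q-irr (∣-trans {q} q∣e e∣p²))

SquareFree-*⁻ˡ : ∀ {a b} → SquareFree (a * b) → SquareFree a
SquareFree-*⁻ˡ {a} {b} (ab≢0 , ab-sqf) =
  (λ a≡0 → ab≢0 (cong (_* b) a≡0)) , λ p p-irr p²∣a → ab-sqf p p-irr (∣-*ʳ {p * p} b p²∣a)

SquareFree-*⁺ : ∀ {a b} → Coprime a b → SquareFree a → SquareFree b → SquareFree (a * b)
SquareFree-*⁺ {a} {b} a⊥b a-sqf b-sqf = *-≢0 {a} {b} (proj₁ a-sqf) (proj₁ b-sqf) , ab-sqf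
  where
  no-square : ∀ {a b p} → Coprime a b → SquareFree a → Irreducible p → p ∣ a → ¬ (p * p ∣ a * b)
  no-square {a} {b} {p} a⊥b (_ , a-sqf) p-irr@(_ , p≢1 , _) p∣a p²∣ab =
    a-sqf p p-irr (coprime-divisor {p * p} {a} {b} (∤⇒Coprime-square p-irr λ p∣b → p≢1 (a⊥b p p∣a p∣b)) p²∣ab)
  ab-sqf : ∀ p → Irreducible p → ¬ (p * p ∣ a * b)
  ab-sqf p p-irr p²∣ab with euclidsLemma {p} a b p-irr (∣-trans {p} (∣-*-self p p) p²∣ab)
  ... | inj₁ p∣a = no-square a⊥b a-sqf p-irr p∣a p²∣ab
  ... | inj₂ p∣b = no-square (Coprime-sym {a} a⊥b) b-sqf p-irr p∣b (subst (p * p ∣_) (*-comm a b) p²∣ab)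

squareFreeᵇ-* : ∀ {a b} → Coprime a b → squareFreeᵇ (a * b) ≡ squareFreeᵇ a ∧ squareFreeᵇ b
squareFreeᵇ-* {a} {b} a⊥b = ⇔→≡ {z = true} (mk⇔ to from)
  where
  to : squareFreeᵇ (a * b) ≡ true → squareFreeᵇ a ∧ squareFreeᵇ b ≡ true
  to ab-sqfᵇ = cong₂ _∧_ (SquareFree⇒squareFreeᵇ (SquareFree-*⁻ˡ {a} {b} ab-sqf))
                         (SquareFree⇒squareFreeᵇ (SquareFree-*⁻ˡ {b} {a} (subst SquareFree (*-comm a b) ab-sqf)))
    where
    ab-sqf : SquareFree (a * b)
    ab-sqf = squareFreeᵇ⇒SquareFree ab-sqfᵇ
  from : squareFreeᵇ a ∧ squareFreeᵇ b ≡ true → squareFreeᵇ (a * b) ≡ true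
  from sqfᵇ with ∧-true⁻ {squareFreeᵇ a} sqfᵇ
  ... | a-sqfᵇ , b-sqfᵇ =
    SquareFree⇒squareFreeᵇ (SquareFree-*⁺ a⊥b (squareFreeᵇ⇒SquareFree a-sqfᵇ) (squareFreeᵇ⇒SquareFree b-sqfᵇ))

sqfTerm : (Poly → Poly) → Poly × Poly → Poly
sqfTerm f (d , c) = if squareFreeᵇ d then f d * σ c else 0p

sqfDivisorSum : (Poly → Poly) → Poly → Poly
sqfDivisorSum f = divisorSum (sqfTerm f)

sqfTerm-multiplicativeOnPairs : ∀ {f} → Multiplicative f → MultiplicativeOnPairs (sqfTerm f)
sqfTerm-multiplicativeOnPairs {f} f-mult d₁ c₁ d₂ c₂ a≢0 b≢0 a⊥b = byCases (squareFreeᵇ-* {d₁} {d₂} d₁⊥d₂)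
  where
  d₁⊥d₂ : Coprime d₁ d₂
  d₁⊥d₂ = Coprime-∣ {d₁ * c₁} {d₂ * c₂} a⊥b (∣-*-self d₁ c₁) (∣-*-self d₂ c₂)
  c₁⊥c₂ : Coprime c₁ c₂
  c₁⊥c₂ = Coprime-∣ {d₁ * c₁} {d₂ * c₂} a⊥b (d₁ , *-comm c₁ d₁) (d₂ , *-comm c₂ d₂)
  fσ-* : f (d₁ * d₂) * σ (c₁ * c₂) ≡ (f d₁ * σ c₁) * (f d₂ * σ c₂)
  fσ-* = trans (cong₂ _*_ (f-mult d₁ d₂ (divisor-≢0 {d₁} {c₁} refl a≢0) (divisor-≢0 {d₂} {c₂} refl b≢0) d₁⊥d₂)
                          (σ-multiplicative c₁ c₂ (cofactor-≢0 {d₁} refl a≢0) (cofactor-≢0 {d₂} refl b≢0) c₁⊥c₂))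
               (interchange (f d₁) (f d₂) (σ c₁) (σ c₂))
    where
    interchange : ∀ p q r s → (p * q) * (r * s) ≡ (p * r) * (q * s)
    interchange = solve-∀ polyRing
  byCases : squareFreeᵇ (d₁ * d₂) ≡ squareFreeᵇ d₁ ∧ squareFreeᵇ d₂ →
            sqfTerm f (d₁ * d₂ , c₁ * c₂) ≡ sqfTerm f (d₁ , c₁) * sqfTerm f (d₂ , c₂)
  byCases eq rewrite eq with squareFreeᵇ d₁ | squareFreeᵇ d₂
  ... | true  | true  = fσ-*
  ... | true  | false = sym (*-zeroʳ (f d₁ * σ c₁))
  ... | false | _     = refl

sqfDivisorSum-multiplicative : ∀ {f} → Multiplicative f → Multiplicative (sqfDivisorSum f)
sqfDivisorSum-multiplicative {f} f-mult = divisorSum-multiplicative (sqfTerm f) (sqfTerm-multiplicativeOnPairs {f} f-mult)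

-- Divisors of p and p * p for irreducible p

sumMap-divisorPairs-list : ∀ {g a} (dcs : List (Poly × Poly)) → a ≢ 0p → Unique dcs →
  (∀ {d c} → d * c ≡ a → (d , c) ∈ dcs) → (∀ {dc} → dc ∈ dcs → proj₁ dc * proj₂ dc ≡ a) →
  sumMap g (divisorPairs a) ≡ sumMap g dcs
sumMap-divisorPairs-list {g} {a} dcs a≢0 u complete sound = sumMap-sameElements g (divisorPairs-unique a) u
  (λ {dc} dc∈ → complete (∈-divisorPairs⁻ {a} dc∈))
  (λ {dc} dc∈ → ∈-divisorPairs⁺ {a} {proj₁ dc} {proj₂ dc} a≢0 (sound dc∈))

module _ {p : Poly} (p-irr : Irreducible p) where

  private
    p≢0 : p ≢ 0p
    p≢0 = proj₁ p-irr
    p≢1 : p ≢ 1p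
    p≢1 = proj₁ (proj₂ p-irr)

  p≢p² : p ≢ p * p
  p≢p² p≡p² = p≢1 (sym (*-cancelˡ p≢0 (trans (*-identityʳ p) p≡p²)))

  1≢p² : 1p ≢ p * p
  1≢p² 1≡p² = p≢1 (*≡1⇒≡1 {p} {p} (sym 1≡p²))

  divisorPairs-irreducible : ∀ g → sumMap g (divisorPairs p) ≡ g (1p , p) + (g (p , 1p) + 0p)
  divisorPairs-irreducible g = sumMap-divisorPairs-list ((1p , p) ∷ (p , 1p) ∷ []) p≢0
    (((λ eq → p≢1 (sym (cong proj₁ eq))) ∷ []) ∷ [] ∷ [])
    complete
    λ { (here refl) → *-identityˡ p ; (there (here refl)) → *-identityʳ p }
    where
    complete : ∀ {d c} → d * c ≡ p → (d , c) ∈ (1p , p) ∷ (p , 1p) ∷ []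
    complete {d} {c} dc≡p with proj₂ (proj₂ p-irr) d (c , dc≡p)
    ... | inj₁ refl = here (cong (1p ,_) (trans (sym (*-identityˡ c)) dc≡p))
    ... | inj₂ refl = there (here (cong (p ,_) (*-cancelˡ p≢0 (trans dc≡p (sym (*-identityʳ p))))))

  divisors-square : ∀ d → d ∣ p * p → d ≡ 1p ⊎ d ≡ p ⊎ d ≡ p * p
  divisors-square d (c , dc≡p²) with d ≟ 1p
  ... | yes d≡1 = inj₁ d≡1
  ... | no  d≢1 with p∣d
    where
    p∣d : p ∣ d
    p∣d with irreducibleFactor d (divisor-≢0 {d} {c} dc≡p² (square-≢0 p≢0)) d≢1
    ... | q , q-irr , q∣d = subst (_∣ d) q≡p q∣d
      where
      q≡p : q ≡ p
      q≡p = irreducible-∣-irreducible p-irr q-irr (irreducible-∣-square q-irr (∣-trans {q} q∣d (c , dc≡p²)))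
  ... | e , pe≡d with proj₂ (proj₂ p-irr) e (c , *-cancelˡ p≢0 (trans (sym (*-assoc p e c)) (trans (cong (_* c) pe≡d) dc≡p²)))
  ...   | inj₁ refl = inj₂ (inj₁ (trans (sym pe≡d) (*-identityʳ p)))
  ...   | inj₂ refl = inj₂ (inj₂ (sym pe≡d))

  divisorPairs-square : ∀ g → sumMap g (divisorPairs (p * p)) ≡ g (1p , p * p) + (g (p , p) + (g (p * p , 1p) + 0p))
  divisorPairs-square g = sumMap-divisorPairs-list ((1p , p * p) ∷ (p , p) ∷ (p * p , 1p) ∷ []) (square-≢0 p≢0)
    (((λ eq → p≢1 (sym (cong proj₁ eq))) ∷ (λ eq → 1≢p² (cong proj₁ eq)) ∷ [])
     ∷ ((λ eq → p≢p² (cong proj₁ eq)) ∷ []) ∷ [] ∷ [])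
    complete
    λ { (here refl) → *-identityˡ (p * p) ; (there (here refl)) → refl ; (there (there (here refl))) → *-identityʳ (p * p) }
    where
    complete : ∀ {d c} → d * c ≡ p * p → (d , c) ∈ (1p , p * p) ∷ (p , p) ∷ (p * p , 1p) ∷ []
    complete {d} {c} dc≡p² with divisors-square d (c , dc≡p²)
    ... | inj₁ refl        = here (cong (1p ,_) (trans (sym (*-identityˡ c)) dc≡p²))
    ... | inj₂ (inj₁ refl) = there (here (cong (p ,_) (*-cancelˡ p≢0 dc≡p²)))
    ... | inj₂ (inj₂ refl) = there (there (here (cong (p * p ,_)
                               (*-cancelˡ (square-≢0 p≢0) (trans dc≡p² (sym (*-identityʳ (p * p))))))))

  σ-irreducible : σ p ≡ 1p + p
  σ-irreducible = trans (divisorPairs-irreducible proj₁) (cong (1p +_) (+-identityʳ p))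

  σ-square : σ (p * p) ≡ 1p + (p + p * p)
  σ-square = trans (divisorPairs-square proj₁) (cong (λ q → 1p + (p + q)) (+-identityʳ (p * p)))

  σ*-irreducible : σ* p ≡ 1p + p
  σ*-irreducible = begin
    σ* p                                                         ≡⟨ sumMap-filter unitary? proj₁ (divisorPairs p) ⟩
    sumMap (λ dc → if does (unitary? dc) then proj₁ dc else 0p) (divisorPairs p)
      ≡⟨ divisorPairs-irreducible _ ⟩
    (if does (unitary? (1p , p)) then 1p else 0p) + ((if does (unitary? (p , 1p)) then p else 0p) + 0p)
      ≡⟨ cong₂ (λ b b′ → (if does (b Bool.≟ true) then 1p else 0p) + ((if does (b′ Bool.≟ true) then p else 0p) + 0p))
               coprimeᵇ-1-p coprimeᵇ-p-1 ⟩
    1p + (p + 0p)                                                ≡⟨ cong (1p +_) (+-identityʳ p) ⟩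
    1p + p                                                       ∎
    where
    open ≡-Reasoning
    unitary? : (dc : Poly × Poly) → Dec (coprimeᵇ (proj₁ dc) (proj₂ dc) ≡ true)
    unitary? dc = coprimeᵇ (proj₁ dc) (proj₂ dc) Bool.≟ true
    -- divisors 1p evaluates to 1p ∷ [].
    coprimeᵇ-1-p : coprimeᵇ 1p p ≡ true
    coprimeᵇ-1-p = cong (_∧ true) (∨-zeroʳ _)
    coprimeᵇ-p-1 : coprimeᵇ p 1p ≡ true
    coprimeᵇ-p-1 = all-true⁺ _ (divisors p) trivial
      where
      trivial : ∀ {e} → e ∈ divisors p → (not (any (λ d → d == e) (divisors 1p)) ∨ (e == 1p)) ≡ true
      trivial {e} e∈ with proj₂ (proj₂ p-irr) e (∈-divisors⁻ {p} e∈)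
      ... | inj₁ refl = refl
      ... | inj₂ refl rewrite ≢⇒==-false {1p} {p} (λ 1≡p → p≢1 (sym 1≡p)) = refl

  Irreducible⇒SquareFree : SquareFree p
  Irreducible⇒SquareFree = p≢0 , no-square
    where
    no-square : ∀ q → Irreducible q → ¬ (q * q ∣ p)
    no-square q q-irr (k , q²k≡p) with proj₂ (proj₂ p-irr) q (q * k , trans (sym (*-assoc q q k)) q²k≡p)
    ... | inj₁ q≡1 = proj₁ (proj₂ q-irr) q≡1
    ... | inj₂ refl = p≢1 (*≡1⇒≡1 {p} {k} (*-cancelˡ p≢0 (trans (sym (*-assoc p p k)) (trans q²k≡p (sym (*-identityʳ p))))))

  squareFreeᵇ-square : squareFreeᵇ (p * p) ≡ false
  squareFreeᵇ-square with squareFreeᵇ (p * p) in p²-sqfᵇ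
  ... | false = refl
  ... | true  = ⊥-elim (proj₂ (squareFreeᵇ⇒SquareFree p²-sqfᵇ) p p-irr (∣-refl (p * p)))


-- The inverse of σ* at 1 and at irreducibles

module _ {f : Poly → Poly} (f-inv : IsσStarInv f) where

  σStarInv-1 : f 1p ≡ 1p
  σStarInv-1 = trans (sym (trans (+-identityʳ (1p * f 1p)) (*-identityˡ (f 1p)))) (proj₂ f-inv 1p λ ())

  sqfDivisorSum-1 : sqfDivisorSum f 1p ≡ 1p
  sqfDivisorSum-1 = trans (+-identityʳ (f 1p * 1p)) (trans (*-identityʳ (f 1p)) σStarInv-1)

  σStarInv-irreducible : ∀ {p} → Irreducible p → f p ≡ 1p + p
  σStarInv-irreducible {p} p-irr = x+y≡0⇒x≡y (begin
    f p + (1p + p)                         ≡⟨ cong₂ _+_ (*-identityˡ (f p)) σ*p·f1 ⟨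
    σ* 1p * f p + (σ* p * f 1p + 0p)       ≡⟨ divisorPairs-irreducible p-irr (λ dc → σ* (proj₁ dc) * f (proj₂ dc)) ⟨
    (σ* ⊛ f) p                             ≡⟨ proj₂ f-inv p (proj₁ p-irr) ⟩
    δ p                                    ≡⟨ cong (λ b → if b then 1p else 0p) (≢⇒==-false (proj₁ (proj₂ p-irr))) ⟩
    0p                                     ∎)
    where
    open ≡-Reasoning
    σ*p·f1 : σ* p * f 1p + 0p ≡ 1p + p
    σ*p·f1 = trans (+-identityʳ _) (trans (cong₂ _*_ (σ*-irreducible p-irr) σStarInv-1) (*-identityʳ (1p + p)))

  sqfDivisorSum-square : ∀ {p} → Irreducible p → sqfDivisorSum f (p * p) ≡ p
  sqfDivisorSum-square {p} p-irr = begin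
    sqfDivisorSum f (p * p)
      ≡⟨ divisorPairs-square p-irr (sqfTerm f) ⟩
    f 1p * σ (p * p) + (sqfTerm f (p , p) + (sqfTerm f (p * p , 1p) + 0p))
      ≡⟨ cong₂ (λ t t′ → f 1p * σ (p * p) + (t + (t′ + 0p)))
               (cong (λ b → if b then f p * σ p else 0p) (SquareFree⇒squareFreeᵇ (Irreducible⇒SquareFree p-irr)))
               (cong (λ b → if b then f (p * p) * σ 1p else 0p) (squareFreeᵇ-square p-irr)) ⟩
    f 1p * σ (p * p) + (f p * σ p + (0p + 0p))
      ≡⟨ cong₂ (λ s t → s + (t + (0p + 0p))) (cong₂ _*_ σStarInv-1 (σ-square p-irr))
                                             (cong₂ _*_ (σStarInv-irreducible p-irr) (σ-irreducible p-irr)) ⟩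
    1p * (1p + (p + p * p)) + ((1p + p) * (1p + p) + (0p + 0p))
      ≡⟨ regroup p ⟩
    p + ((1p + 1p) + ((p + p) + (p * p + p * p)))
      ≡⟨ cong (p +_) (cong₂ _+_ (x+x≡0 1p) (cong₂ _+_ (x+x≡0 p) (x+x≡0 (p * p)))) ⟩
    p + 0p
      ≡⟨ +-identityʳ p ⟩
    p ∎
    where
    open ≡-Reasoning
    regroup : ∀ p → 1p * (1p + (p + p * p)) + ((1p + p) * (1p + p) + (0p + 0p)) ≡ p + ((1p + 1p) + ((p + p) + (p * p + p * p)))
    regroup = solve-∀ polyRing

irreducibleDivisors : Poly → List Poly
irreducibleDivisors a = filter (λ d → irreducibleᵇ d Bool.≟ true) (divisors a)

∈-irreducibleDivisors⁻ : ∀ {a q} → q ∈ irreducibleDivisors a → q ∣ a × Irreducible q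
∈-irreducibleDivisors⁻ {a} q∈ with ∈-filter⁻ (λ d → irreducibleᵇ d Bool.≟ true) {xs = divisors a} q∈
... | q∈divisors , q-irrᵇ = ∈-divisors⁻ {a} q∈divisors , irreducibleᵇ⇒Irreducible q-irrᵇ

∈-irreducibleDivisors⁺ : ∀ {a q} → a ≢ 0p → q ∣ a → Irreducible q → q ∈ irreducibleDivisors a
∈-irreducibleDivisors⁺ {a} {q} a≢0 q∣a q-irr =
  ∈-filter⁺ (λ d → irreducibleᵇ d Bool.≟ true) (∈-divisors⁺ {a} {q} a≢0 q∣a) (Irreducible⇒irreducibleᵇ q-irr)

irreducibleDivisors-unique : ∀ {a} → a ≢ 0p → Unique (irreducibleDivisors a)
irreducibleDivisors-unique {a} a≢0 = Unique.filter⁺ (λ d → irreducibleᵇ d Bool.≟ true) (divisors-unique a a≢0)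

prodP-++ : ∀ ps qs → prodP (ps ++ qs) ≡ prodP ps * prodP qs
prodP-++ []       qs = sym (*-identityˡ (prodP qs))
prodP-++ (p ∷ ps) qs = trans (cong (p *_) (prodP-++ ps qs)) (sym (*-assoc p (prodP ps) (prodP qs)))

rad-multiplicative : Multiplicative rad
rad-multiplicative a b a≢0 b≢0 a⊥b =
  trans (prodP-↭ (Unique-⊆-↭ (irreducibleDivisors-unique {a * b} ab≢0) unique-++ ⊆-++ ++-⊆))
        (prodP-++ (irreducibleDivisors a) (irreducibleDivisors b))
  where
  ab≢0 : a * b ≢ 0p
  ab≢0 = *-≢0 {a} {b} a≢0 b≢0
  unique-++ : Unique (irreducibleDivisors a ++ irreducibleDivisors b)
  unique-++ = Unique.++⁺ (irreducibleDivisors-unique a≢0) (irreducibleDivisors-unique b≢0) λ (q∈a , q∈b) →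
    let (q∣a , q-irr) = ∈-irreducibleDivisors⁻ {a} q∈a in
    proj₁ (proj₂ q-irr) (a⊥b _ q∣a (proj₁ (∈-irreducibleDivisors⁻ {b} q∈b)))
  ⊆-++ : ∀ {q} → q ∈ irreducibleDivisors (a * b) → q ∈ irreducibleDivisors a ++ irreducibleDivisors b
  ⊆-++ {q} q∈ with ∈-irreducibleDivisors⁻ {a * b} q∈
  ... | q∣ab , q-irr = fromEuclid (euclidsLemma {q} a b q-irr q∣ab)
    where
    fromEuclid : q ∣ a ⊎ q ∣ b → q ∈ irreducibleDivisors a ++ irreducibleDivisors b
    fromEuclid (inj₁ q∣a) = ∈-++⁺ˡ (∈-irreducibleDivisors⁺ a≢0 q∣a q-irr)
    fromEuclid (inj₂ q∣b) = ∈-++⁺ʳ (irreducibleDivisors a) (∈-irreducibleDivisors⁺ b≢0 q∣b q-irr)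
  ++-⊆ : ∀ {q} → q ∈ irreducibleDivisors a ++ irreducibleDivisors b → q ∈ irreducibleDivisors (a * b)
  ++-⊆ {q} q∈ = fromEither (∈-++⁻ (irreducibleDivisors a) q∈)
    where
    fromEither : q ∈ irreducibleDivisors a ⊎ q ∈ irreducibleDivisors b → q ∈ irreducibleDivisors (a * b)
    fromEither (inj₁ q∈a) = let (q∣a , q-irr) = ∈-irreducibleDivisors⁻ {a} q∈a in
      ∈-irreducibleDivisors⁺ ab≢0 (∣-*ʳ {q} b q∣a) q-irr
    fromEither (inj₂ q∈b) = let (q∣b , q-irr) = ∈-irreducibleDivisors⁻ {b} q∈b in
      ∈-irreducibleDivisors⁺ ab≢0 (∣-*ˡ {q} a q∣b) q-irr

rad-square : ∀ {p} → Irreducible p → rad (p * p) ≡ p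
rad-square {p} p-irr =
  trans (prodP-↭ (Unique-⊆-↭ (irreducibleDivisors-unique {p * p} p²≢0) ([] ∷ []) ⊆-[p] [p]-⊆)) (*-identityʳ p)
  where
  p²≢0 : p * p ≢ 0p
  p²≢0 = square-≢0 (proj₁ p-irr)
  ⊆-[p] : ∀ {q} → q ∈ irreducibleDivisors (p * p) → q ∈ p ∷ []
  ⊆-[p] {q} q∈ = let (q∣p² , q-irr) = ∈-irreducibleDivisors⁻ {p * p} q∈ in
    here (irreducible-∣-irreducible p-irr q-irr (irreducible-∣-square q-irr q∣p²))
  [p]-⊆ : ∀ {q} → q ∈ p ∷ [] → q ∈ irreducibleDivisors (p * p)
  [p]-⊆ (here refl) = ∈-irreducibleDivisors⁺ p²≢0 (∣-*-self p p) p-irr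

SquareFree-peel : ∀ {s} → SquareFree s → s ≢ 1p →
  ∃₂ λ p t → Irreducible p × ¬ (p ∣ t) × SquareFree t × p * t ≡ s
SquareFree-peel {s} s-sqf@(s≢0 , no-square) s≢1 with irreducibleFactor s s≢0 s≢1
... | p , p-irr , t , pt≡s = p , t , p-irr , p∤t , t-sqf , pt≡s
  where
  p∤t : ¬ (p ∣ t)
  p∤t (k , pk≡t) = no-square p p-irr (k , trans (*-assoc p p k) (trans (cong (p *_) pk≡t) pt≡s))
  t-sqf : SquareFree t
  t-sqf = SquareFree-*⁻ˡ {t} {p} (subst SquareFree (sym (trans (*-comm t p) pt≡s)) s-sqf)

module _ {g : Poly → Poly} (g-mult : Multiplicative g) (g-1 : g 1p ≡ 1p)
         (g-square : ∀ {p} → Irreducible p → g (p * p) ≡ p) where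

  private
    square-* : ∀ p t → (p * t) * (p * t) ≡ (p * p) * (t * t)
    square-* = solve-∀ polyRing

  square-squareFreeBounded : ∀ n {s} → deg s ≤ n → SquareFree s → g (s * s) ≡ s
  square-squareFreeBounded n {s} deg≤n s-sqf with s ≟ 1p
  ... | yes refl = g-1
  ... | no  s≢1 with SquareFree-peel s-sqf s≢1 | n
  ...   | _ , _ , _ , _ , _ , _ | zero = ⊥-elim (s≢1 (deg≡0⇒≡1 (proj₁ s-sqf) (ℕ.n≤0⇒n≡0 deg≤n)))
  ...   | p , t , p-irr , p∤t , t-sqf , pt≡s | suc m = begin
    g (s * s)                    ≡⟨ cong g (trans (cong₂ _*_ (sym pt≡s) (sym pt≡s)) (square-* p t)) ⟩
    g ((p * p) * (t * t))        ≡⟨ g-mult (p * p) (t * t) (square-≢0 (proj₁ p-irr)) (square-≢0 (proj₁ t-sqf)) p²⊥t² ⟩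
    g (p * p) * g (t * t)        ≡⟨ cong₂ _*_ (g-square p-irr) (square-squareFreeBounded m deg-t≤m t-sqf) ⟩
    p * t                        ≡⟨ pt≡s ⟩
    s                            ∎
    where
    open ≡-Reasoning
    p²⊥t² : Coprime (p * p) (t * t)
    p²⊥t² = ∤⇒Coprime-square p-irr (λ p∣t² → p∤t (irreducible-∣-square p-irr p∣t²))
    deg-t≤m : deg t ≤ m
    deg-t≤m = ℕ.≤-pred (ℕ.<-≤-trans (deg-divisor-< {t} {p} (trans (*-comm t p) pt≡s) (proj₁ s-sqf) (proj₁ (proj₂ p-irr))) deg≤n)

  square-squareFree : ∀ {s} → SquareFree s → g (s * s) ≡ s
  square-squareFree {s} = square-squareFreeBounded (deg s) ℕ.≤-refl

-- Splitting off the term d = 1 when a is not square-free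

module _ {f : Poly → Poly} (f-inv : IsσStarInv f) {a : Poly} (a≢0 : a ≢ 0p) (a≢1 : a ≢ 1p)
         (a-not-sqf : squareFreeᵇ a ≡ false) (a-perfect : Perfect a) where

  private
    term : Poly × Poly → Poly
    term (d , c) = f d * σ c

    corollaryPair? : (dc : Poly × Poly) → Dec (not (proj₁ dc == a) ∧ not (proj₁ dc == 1p) ∧ squareFreeᵇ (proj₁ dc) ≡ true)
    corollaryPair? (d , c) = not (d == a) ∧ not (d == 1p) ∧ squareFreeᵇ d Bool.≟ true

    corollaryTerm : Poly × Poly → Poly
    corollaryTerm dc = if does (corollaryPair? dc) then term dc else 0p

    unitTerm : Poly × Poly → Poly
    unitTerm (d , c) = if d == 1p then term (d , c) else 0p

    sqfTerm-split : ∀ dc → sqfTerm f dc ≡ corollaryTerm dc + unitTerm dc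
    sqfTerm-split (d , c) with d ≟ 1p
    ... | yes refl rewrite ≢⇒==-false {1p} {a} (λ 1≡a → a≢1 (sym 1≡a)) = sym (+-identityˡ (f 1p * σ c))
    ... | no  d≢1 with d ≟ a
    ...   | yes refl rewrite a-not-sqf = refl
    ...   | no  d≢a with squareFreeᵇ d
    ...     | true  = sym (+-identityʳ (f d * σ c))
    ...     | false = refl

    unitTerms : sumMap unitTerm (divisorPairs a) ≡ a
    unitTerms = trans (sumMap-single (divisorPairs a) (divisorPairs-unique a) (∈-divisorPairs⁺ {a} {1p} {a} a≢0 (*-identityˡ a)) others)
                      (trans (cong (_* σ a) (σStarInv-1 {f} f-inv)) (trans (*-identityˡ (σ a)) a-perfect))
      where
      others : ∀ {dc} → dc ∈ divisorPairs a → dc ≢ (1p , a) → unitTerm dc ≡ 0p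
      others {d , c} dc∈ dc≢ with d ≟ 1p
      ... | yes refl = ⊥-elim (dc≢ (cong (1p ,_) (trans (sym (*-identityˡ c)) (∈-divisorPairs⁻ {a} dc∈))))
      ... | no  _    = refl

  sqfDivisorSum-split : sqfDivisorSum f a ≡ corSum f a + a
  sqfDivisorSum-split = begin
    sumMap (sqfTerm f) (divisorPairs a)                                      ≡⟨ sumMap-cong (divisorPairs a) (λ {dc} _ → sqfTerm-split dc) ⟩
    sumMap (λ dc → corollaryTerm dc + unitTerm dc) (divisorPairs a)          ≡⟨ sumMap-+ corollaryTerm unitTerm (divisorPairs a) ⟩
    sumMap corollaryTerm (divisorPairs a) + sumMap unitTerm (divisorPairs a) ≡⟨ cong₂ _+_ (sym (sumMap-filter corollaryPair? term (divisorPairs a))) unitTerms ⟩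
    corSum f a + a                                                           ∎
    where open ≡-Reasoning

square-not-squareFree : ∀ {s} → s ≢ 0p → s ≢ 1p → squareFreeᵇ (s * s) ≡ false
square-not-squareFree {s} s≢0 s≢1 with squareFreeᵇ (s * s) in s²-sqfᵇ | irreducibleFactor s s≢0 s≢1
... | false | _ = refl
... | true  | p , p-irr , t , pt≡s =
  ⊥-elim (proj₂ (squareFreeᵇ⇒SquareFree s²-sqfᵇ) p p-irr (t * t , trans (square-* p t) (cong₂ _*_ pt≡s pt≡s)))
  where
  square-* : ∀ p t → (p * p) * (t * t) ≡ (p * t) * (p * t)
  square-* = solve-∀ polyRing

corollary4p26 : (f : Poly → Poly) → IsσStarInv f → (A : Poly) → Special A → Perfect A →
                  A ≡ rad A + corSum f A
corollary4p26 f f-inv A (S , S-sqf , A≡S²) A-perfect with S ≟ 1p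
... | yes refl rewrite A≡S² = refl
... | no  S≢1 = begin
  A                                ≡⟨ x+y+y≡x A (corSum f A) ⟨
  (A + corSum f A) + corSum f A    ≡⟨ cong (_+ corSum f A) (trans (+-comm A (corSum f A)) (sym split)) ⟩
  sqfDivisorSum f A + corSum f A   ≡⟨ cong (_+ corSum f A) (trans sqfDivisorSum≡S (sym rad≡S)) ⟩
  rad A + corSum f A               ∎
  where
  open ≡-Reasoning
  S≢0 : S ≢ 0p
  S≢0 = proj₁ S-sqf
  split : sqfDivisorSum f A ≡ corSum f A + A
  split = sqfDivisorSum-split {f} f-inv {A}
    (λ A≡0 → square-≢0 S≢0 (trans (sym A≡S²) A≡0))
    (λ A≡1 → S≢1 (*≡1⇒≡1 {S} {S} (trans (sym A≡S²) A≡1)))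
    (trans (cong squareFreeᵇ A≡S²) (square-not-squareFree S≢0 S≢1)) A-perfect
  sqfDivisorSum≡S : sqfDivisorSum f A ≡ S
  sqfDivisorSum≡S = trans (cong (sqfDivisorSum f) A≡S²)
    (square-squareFree {sqfDivisorSum f} (sqfDivisorSum-multiplicative {f} (proj₁ f-inv))
      (sqfDivisorSum-1 {f} f-inv) (sqfDivisorSum-square {f} f-inv) S-sqf)
  rad≡S : rad A ≡ S
  rad≡S = trans (cong rad A≡S²) (square-squareFree {rad} rad-multiplicative refl rad-square S-sqf)
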